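{- For every $0<\delta<1/2$ there exists $\eta>0$ (depending on $d_c$) such that, with probability tending to $1$ as $n\to\infty$, the parity-check graph of a random $(d_v,d_c)$-LDPC code with block length $n$ is $(\eta n,1+\delta)$-expanding.
   Context: Random $(d_v,d_c)$-LDPC code: let $n$ be the block length and $m$ the number of checks, with $M := n d_v = m d_c$. Assign $d_v$ sockets to each of $n$ left (variable) vertices and $d_c$ sockets to each of $m$ right (check) vertices, numbering sockets $1,\dots,M$ on each side. Sample a uniformly random permutation $\pi$ of $\{1,\dots,M\}$ and join left socket $i$ to right socket $\pi(i)$. The parity-check graph has an edge between variable $i$ and check $j$ iff there is an odd number of socket edges between them. A parity-check graph is $(s,\alpha)$-expanding if for every set of $s'\le s$ check nodes $j_1,\dots,j_{s'}$ with neighborhoods $N(j_1),\dots,N(j_{s'})$ among the variable nodes, $|\bigcup_{r}N(j_r)|\ge\sum_r|N(j_r)|-\alpha s'$. -}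

module Defs where

open import Data.Nat using (ℕ; zero; suc; _*_; NonZero; _!)
open import Data.Nat.DivMod using (_/_; _%_)
import Data.Nat as ℕ
open import Data.Fin using (Fin; toℕ)
open import Data.Fin.Permutation using (Permutation′; _⟨$⟩ʳ_)
open import Data.List using (List; length; filter; map; allFin; _∷_; [])
open import Data.Nat.ListAction using (sum)
open import Data.List.Relation.Unary.Any using (Any)
open import Data.List.Relation.Unary.Unique.Propositional using (Unique)
open import Data.Product using (_×_)
open import Relation.Binary.PropositionalEquality using (_≡_)
open import Relation.Nullary.Decidable using (_×-dec_)
open import Data.Integer using (+_)
open import Data.Rational using (ℚ; _≤_)
import Data.Rational as ℚ

ℕ→ℚ : ℕ → ℚ
ℕ→ℚ k = (+ k) ℚ./ 1

-- Sockets of the configuration model.  Left socket i (0-based) belongs to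
-- variable ⌊i / d_v⌋, right socket j belongs to check ⌊j / d_c⌋.
-- The graph is given by a permutation π of the M = n * d_v sockets.
module _ (dv dc n m : ℕ) .{{_ : NonZero dv}} .{{_ : NonZero dc}} where

  Sockets : Set
  Sockets = Permutation′ (n * dv)

  multiplicity : Sockets → Fin n → Fin m → ℕ
  multiplicity π v c =
    length (filter (λ i → (toℕ i / dv ℕ.≟ toℕ v) ×-dec (toℕ (π ⟨$⟩ʳ i) / dc ℕ.≟ toℕ c))
                   (allFin (n * dv)))

  Adjacent : Sockets → Fin n → Fin m → Set
  Adjacent π v c = multiplicity π v c % 2 ≡ 1

  degree : Sockets → Fin m → ℕ
  degree π c = length (filter (λ v → multiplicity π v c % 2 ℕ.≟ 1) (allFin n))

  unionSize : Sockets → List (Fin m) → ℕ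
  unionSize π S =
    length (filter (λ v → Data.List.Relation.Unary.Any.any? (λ c → multiplicity π v c % 2 ℕ.≟ 1) S)
                   (allFin n))

  Expanding : Sockets → ℚ → ℚ → Set
  Expanding π s α =
    (S : List (Fin m)) → Unique S → ℕ→ℚ (length S) ≤ s →
    ℕ→ℚ (sum (map (degree π) S)) ≤ ℕ→ℚ (unionSize π S) ℚ.+ α ℚ.* ℕ→ℚ (length S)

  SamePerm : Sockets → Sockets → Set
  SamePerm σ π = (i : Fin (n * dv)) → σ ⟨$⟩ʳ i ≡ π ⟨$⟩ʳ i

  -- "Pr_π [ ¬ P π ] ≤ ε" for π uniform on the M! permutations:
  -- the bad permutations are covered by a list of length ≤ ε · M!.
  FailureProbAtMost : (Sockets → Set) → ℚ → Set
  FailureProbAtMost P ε =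
    Data.Product.Σ (List Sockets) λ L →
      (ℕ→ℚ (length L) ≤ ε ℚ.* ℕ→ℚ ((n * dv) !)) ×
      ((π : Sockets) → (P π → Data.Empty.⊥) → Any (SamePerm π) L)
    where import Data.Empty

-- A permutation π spoils (ηn, 1 + δ)-expansion only through a set S of s ≤ ηn
-- checks with Σ |N(c)| > |⋃ N(c)| + (1 + δ) s. Comparing, at every variable,
-- the odd multiplicities towards S with the total multiplicity gives
-- Σ |N(c)| + #(variables touched by S) ≤ |⋃ N(c)| + dc s, so the dc s sockets
-- of S are sent into the sockets of at most u = dc s − s − ⌊s/q⌋ − 1 variables
-- (δ ≥ 1/q). The bad permutations are therefore covered by the explicit list,
-- over s, s-sets T of checks and u-sets W of variables, of the permutations
-- sending the sockets of T into those of W, which has at most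
-- C(m,s) C(n,u) (dv u)^(dc s) (M − dc s)! members, M = n dv. With s^s ≤ 4^s s!
-- and (M − k)! (M − k)^k ≤ M!, the term for s is at most C₀ M! / (n 2^s) while
-- s H ≤ n, so the list has at most C₀ M! / n members: a fraction ε of the M!
-- permutations once n ≥ C₀ / ε.
module Submission where

open import Defs

import Algebra.Properties.Semiring.Sum as FinSum
open import Data.Bool using (Bool; true; false; not; _∧_; _∨_)
open import Data.Bool.ListAction using (any)
open import Data.Bool.Properties using (T-≡; ∨-zeroʳ)
open import Data.Empty using (⊥-elim)
open import Data.Fin using (Fin; zero; suc; toℕ; punchIn; fromℕ<)
open import Data.Fin.Permutation as Perm using (Permutation′; _⟨$⟩ʳ_; _⟨$⟩ˡ_; insert; remove; flip)
open import Data.Fin.Properties as Fin using (toℕ<n; toℕ-injective; toℕ-fromℕ<; all?)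
open import Data.Integer as ℤ using (-[1+_])
import Data.Integer.Properties as ℤ
open import Data.List using (List; []; _∷_; [_]; length; map; concat; concatMap; tabulate; filter; filterᵇ; _++_)
open import Data.List.Membership.Propositional using (_∈_)
open import Data.List.Properties using (length-++; length-map; map-cong)
open import Data.List.Relation.Unary.All as All using (All)
open import Data.List.Relation.Unary.All.Properties using (All¬⇒¬Any) renaming (map⁺ to All-map⁺; ++⁺ to All-++⁺)
open import Data.List.Relation.Unary.AllPairs using (_∷_)
open import Data.List.Relation.Unary.Any as Any using (Any; here; there; any?)
open import Data.List.Relation.Unary.Any.Properties using (map⁺; ++⁺ˡ; ++⁺ʳ; concat⁺; concatMap⁺; tabulate⁺)
open import Data.List.Relation.Unary.Unique.Propositional using (Unique)
open import Data.Nat using (ℕ; zero; suc; _+_; _*_; _∸_; _^_; _!; _≤_; _<_; z≤n; s≤s; _≡ᵇ_; _<ᵇ_; _≤?_; _≟_;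
  NonZero; >-nonZero; >-nonZero⁻¹)
import Data.Nat.Coprimality as Coprimality
open Coprimality using (Coprime)
open import Data.Nat.DivMod using (_/_; _%_; m<n⇒m/n≡0; m/n≡1+[m∸n]/n; m<n*o⇒m/o<n; m≡m%n+[m/n]*n; m%n<n; m/n≤m;
  m/n*n≤m; m*n/n≡m; /-monoˡ-≤)
open import Data.Nat.ListAction using (sum)
open import Data.Nat.Properties
open import Data.Nat.Tactic.RingSolver using (solve-∀)
open import Data.Product using (Σ-syntax; ∃-syntax; ∃₂; _×_; _,_; proj₁; proj₂)
open import Data.Rational as ℚ using (ℚ; mkℚ; 0ℚ; 1ℚ; toℚᵘ)
open import Data.Rational.Properties using (normalize-coprime; toℚᵘ-mono-≤; toℚᵘ-cancel-≤; toℚᵘ-cong; toℚᵘ-homo-*;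
  toℚᵘ-homo-+; positive⁻¹)
open import Data.Rational.Unnormalised as ℚᵘ using (mkℚᵘ; *≤*; *≡*)
import Data.Rational.Unnormalised.Properties as ℚᵘ
open import Data.Vec using (Vec; []; _∷_)
import Data.Vec as Vec
open import Function using (_∘_)
open import Function.Bundles using (Equivalence)
open import Relation.Binary.PropositionalEquality hiding ([_])
open import Relation.Nullary using (does; yes; no; ¬_; contradiction)
open import Relation.Nullary.Decidable using (decidable-stable)
open import Relation.Unary using (Decidable)

open FinSum +-*-semiring using (sum-syntax; ∑-distrib-+; ∑-comm; sum-permute; sum-remove; sum-cong-≗;
  sum-replicate-zero; *-distribʳ-sum) renaming (sum to ∑)

-- Finite sums and counting

𝟙 : Bool → ℕ
𝟙 true  = 1
𝟙 false = 0

𝟙≤1 : ∀ b → 𝟙 b ≤ 1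
𝟙≤1 true  = ≤-refl
𝟙≤1 false = z≤n

𝟙-∧ : ∀ a b → 𝟙 (a ∧ b) ≡ 𝟙 a * 𝟙 b
𝟙-∧ true  b = sym (+-identityʳ (𝟙 b))
𝟙-∧ false b = refl

∑-mono-≤ : ∀ {N} {f g : Fin N → ℕ} → (∀ i → f i ≤ g i) → ∑ f ≤ ∑ g
∑-mono-≤ {zero}  f≤g = z≤n
∑-mono-≤ {suc N} f≤g = +-mono-≤ (f≤g zero) (∑-mono-≤ (f≤g ∘ suc))

count : ∀ {N} → (Fin N → Bool) → ℕ
count {N} p = ∑[ i < N ] 𝟙 (p i)

count≤ : ∀ {N} (p : Fin N → Bool) → count p ≤ N
count≤ {zero}  p = z≤n
count≤ {suc N} p = +-mono-≤ (𝟙≤1 (p zero)) (count≤ (p ∘ suc))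

count+count-not : ∀ {N} (p : Fin N → Bool) → count p + count (not ∘ p) ≡ N
count+count-not {zero}  p = refl
count+count-not {suc N} p with p zero
... | true  = cong suc (count+count-not (p ∘ suc))
... | false = trans (+-suc _ _) (cong suc (count+count-not (p ∘ suc)))

count-punchIn : ∀ {N} (p : Fin (suc N) → Bool) j → count (p ∘ punchIn j) ≡ count p ∸ 𝟙 (p j)
count-punchIn p j = sym (trans (cong (_∸ 𝟙 (p j)) (sum-remove {i = j} (𝟙 ∘ p))) (m+n∸m≡n (𝟙 (p j)) _))

count-∨ : ∀ {N} (p q : Fin N → Bool) → (∀ i → p i ∧ q i ≡ false) →
          count (λ i → p i ∨ q i) ≡ count p + count q
count-∨ {zero}  p q disjoint = refl
count-∨ {suc N} p q disjoint with p zero | q zero | disjoint zero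
... | true  | true  | ()
... | true  | false | _ = cong suc (count-∨ (p ∘ suc) (q ∘ suc) (disjoint ∘ suc))
... | false | true  | _ = trans (cong suc (count-∨ (p ∘ suc) (q ∘ suc) (disjoint ∘ suc))) (sym (+-suc _ _))
... | false | false | _ = count-∨ (p ∘ suc) (q ∘ suc) (disjoint ∘ suc)

∑-bool : ∀ {N} (p : Fin N → Bool) (g : Bool → ℕ) →
  ∑[ j < N ] g (p j) ≡ count p * g true + count (not ∘ p) * g false
∑-bool {zero}  p g = refl
∑-bool {suc N} p g with p zero
... | true  = trans (cong (g true +_) (∑-bool (p ∘ suc) g)) (sym (+-assoc (g true) _ _))
... | false = trans (cong (g false +_) (∑-bool (p ∘ suc) g)) (x+[y+z]≡y+[x+z] (g false) (count (p ∘ suc) * g true) _)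
  where
  x+[y+z]≡y+[x+z] : ∀ x y z → x + (y + z) ≡ y + (x + z)
  x+[y+z]≡y+[x+z] = solve-∀

count-pos : ∀ {N} (p : Fin N → Bool) i → p i ≡ true → 1 ≤ count p
count-pos p zero    pi rewrite pi = s≤s z≤n
count-pos p (suc i) pi = ≤-trans (count-pos (p ∘ suc) i pi) (m≤n+m _ (𝟙 (p zero)))

sumRange : (ℕ → ℕ) → ℕ → ℕ
sumRange g N = ∑[ i < N ] g (toℕ i)

sumRange-cong : ∀ N {g h : ℕ → ℕ} → (∀ i → i < N → g i ≡ h i) → sumRange g N ≡ sumRange h N
sumRange-cong N g≡h = sum-cong-≗ (λ i → g≡h (toℕ i) (toℕ<n i))

sumRange-+ : ∀ a b (g : ℕ → ℕ) → sumRange g (a + b) ≡ sumRange g a + sumRange (λ i → g (a + i)) b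
sumRange-+ zero    b g = refl
sumRange-+ (suc a) b g = trans (cong (g 0 +_) (sumRange-+ a b (g ∘ suc))) (sym (+-assoc (g 0) _ _))

sumRange-const : ∀ N c → sumRange (λ _ → c) N ≡ N * c
sumRange-const zero    c = refl
sumRange-const (suc N) c = cong (c +_) (sumRange-const N c)

sumRange-blocks : ∀ d .{{_ : NonZero d}} (h : ℕ → ℕ) n → sumRange (λ i → h (i / d)) (n * d) ≡ d * sumRange h n
sumRange-blocks d h zero    = sym (*-zeroʳ d)
sumRange-blocks d h (suc n) = begin
  sumRange (λ i → h (i / d)) (d + n * d)
    ≡⟨ sumRange-+ d (n * d) (λ i → h (i / d)) ⟩
  sumRange (λ i → h (i / d)) d + sumRange (λ i → h ((d + i) / d)) (n * d)
    ≡⟨ cong₂ _+_ (sumRange-cong d (λ i i<d → cong h (m<n⇒m/n≡0 i<d)))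
                 (sumRange-cong (n * d) (λ i _ → cong h ([d+i]/d≡1+i/d i))) ⟩
  sumRange (λ _ → h 0) d + sumRange (λ i → h (suc (i / d))) (n * d)
    ≡⟨ cong₂ _+_ (sumRange-const d (h 0)) (sumRange-blocks d (h ∘ suc) n) ⟩
  d * h 0 + d * sumRange (h ∘ suc) n
    ≡⟨ sym (*-distribˡ-+ d (h 0) _) ⟩
  d * sumRange h (suc n) ∎
  where
  open ≡-Reasoning
  [d+i]/d≡1+i/d : ∀ i → (d + i) / d ≡ suc (i / d)
  [d+i]/d≡1+i/d i = trans (m/n≡1+[m∸n]/n (m≤m+n d i)) (cong (λ x → suc (x / d)) (m+n∸m≡n d i))

sumRange-𝟙≡ᵇˡ : ∀ N x → x < N → sumRange (λ y → 𝟙 (x ≡ᵇ y)) N ≡ 1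
sumRange-𝟙≡ᵇˡ (suc N) zero    _         = cong suc (sum-replicate-zero N)
sumRange-𝟙≡ᵇˡ (suc N) (suc x) (s≤s x<N) = sumRange-𝟙≡ᵇˡ N x x<N

sumRange-𝟙≡ᵇʳ : ∀ N x → x < N → sumRange (λ y → 𝟙 (y ≡ᵇ x)) N ≡ 1
sumRange-𝟙≡ᵇʳ (suc N) zero    _         = cong suc (sum-replicate-zero N)
sumRange-𝟙≡ᵇʳ (suc N) (suc x) (s≤s x<N) = sumRange-𝟙≡ᵇʳ N x x<N

sumTo : (ℕ → ℕ) → ℕ → ℕ
sumTo x zero    = 0
sumTo x (suc k) = x (suc k) + sumTo x k

countL : {A : Set} → (A → Bool) → List A → ℕ
countL p []       = 0
countL p (x ∷ xs) = 𝟙 (p x) + countL p xs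

length-filterᵇ : {A : Set} (p : A → Bool) (xs : List A) → length (filterᵇ p xs) ≡ countL p xs
length-filterᵇ p []       = refl
length-filterᵇ p (x ∷ xs) with p x
... | true  = cong suc (length-filterᵇ p xs)
... | false = length-filterᵇ p xs

length-filter-tabulate : ∀ {N} {A : Set} {ℓ} {P : A → Set ℓ} (P? : Decidable P) (f : Fin N → A) →
  length (filter P? (tabulate f)) ≡ count (λ i → does (P? (f i)))
length-filter-tabulate {zero}  P? f = refl
length-filter-tabulate {suc N} P? f with does (P? (f zero))
... | true  = cong suc (length-filter-tabulate P? (f ∘ suc))
... | false = length-filter-tabulate P? (f ∘ suc)

countL-++ : {A : Set} (p : A → Bool) (xs ys : List A) → countL p (xs ++ ys) ≡ countL p xs + countL p ys
countL-++ p []       ys = refl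
countL-++ p (x ∷ xs) ys = trans (cong (𝟙 (p x) +_) (countL-++ p xs ys)) (sym (+-assoc (𝟙 (p x)) _ _))

countL-map : {A B : Set} (p : B → Bool) (f : A → B) (xs : List A) → countL p (map f xs) ≡ countL (p ∘ f) xs
countL-map p f []       = refl
countL-map p f (x ∷ xs) = cong (𝟙 (p (f x)) +_) (countL-map p f xs)

countL-concat-tabulate : ∀ {N} {A : Set} (p : A → Bool) (f : Fin N → List A) →
  countL p (concat (tabulate f)) ≡ ∑[ j < N ] countL p (f j)
countL-concat-tabulate {zero}  p f = refl
countL-concat-tabulate {suc N} p f =
  trans (countL-++ p (f zero) _) (cong (countL p (f zero) +_) (countL-concat-tabulate p (f ∘ suc)))

countL-cong : {A : Set} {p q : A → Bool} (xs : List A) → (∀ x → p x ≡ q x) → countL p xs ≡ countL q xs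
countL-cong []       p≡q = refl
countL-cong (x ∷ xs) p≡q = cong₂ _+_ (cong 𝟙 (p≡q x)) (countL-cong xs p≡q)

countL-∧ˡ : {A : Set} (b : Bool) (q : A → Bool) (xs : List A) → countL (λ x → b ∧ q x) xs ≡ 𝟙 b * countL q xs
countL-∧ˡ true  q xs       = sym (+-identityʳ _)
countL-∧ˡ false q []       = refl
countL-∧ˡ false q (x ∷ xs) = countL-∧ˡ false q xs

Any-filterᵇ⁺ : {A : Set} {P : A → Set} (p : A → Bool) {xs : List A} →
  (∀ {x} → P x → p x ≡ true) → Any P xs → Any P (filterᵇ p xs)
Any-filterᵇ⁺ p {x ∷ xs} P⇒p (here px) rewrite P⇒p px = here px
Any-filterᵇ⁺ p {x ∷ xs} P⇒p (there a) with p x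
... | true  = there (Any-filterᵇ⁺ p P⇒p a)
... | false = Any-filterᵇ⁺ p P⇒p a

length-concatMap≤ : {A B : Set} {P : A → Set} (f : A → List B) (K : ℕ) {xs : List A} →
  (∀ {x} → P x → length (f x) ≤ K) → All P xs → length (concatMap f xs) ≤ length xs * K
length-concatMap≤ f K bound All.[]                 = z≤n
length-concatMap≤ f K bound (All._∷_ {x = x} px pxs) =
  ≤-trans (≤-reflexive (length-++ (f x))) (+-mono-≤ (bound px) (length-concatMap≤ f K bound pxs))

sum-map-const : {A : Set} (S : List A) (k : ℕ) → sum (map (λ _ → k) S) ≡ length S * k
sum-map-const []      k = refl
sum-map-const (x ∷ S) k = cong (k +_) (sum-map-const S k)

sum-map-∑ : ∀ {K} {A : Set} (S : List A) (g : A → Fin K → ℕ) →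
  sum (map (λ c → ∑[ i < K ] g c i) S) ≡ ∑[ i < K ] sum (map (λ c → g c i) S)
sum-map-∑ {K} []      g = sym (sum-replicate-zero K)
sum-map-∑     (x ∷ S) g = trans (cong (∑ (g x) +_) (sum-map-∑ S g)) (sym (∑-distrib-+ (g x) _))

≡ᵇ-true⇒≡ : ∀ x y → (x ≡ᵇ y) ≡ true → x ≡ y
≡ᵇ-true⇒≡ x y e = ≡ᵇ⇒≡ x y (Equivalence.from T-≡ e)

≡⇒≡ᵇ-true : ∀ {x y} → x ≡ y → (x ≡ᵇ y) ≡ true
≡⇒≡ᵇ-true {x} {y} e = Equivalence.to T-≡ (≡⇒≡ᵇ x y e)

does-any? : {A : Set} {P : A → Set} (P? : Decidable P) (S : List A) → does (any? P? S) ≡ any (does ∘ P?) S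
does-any? P? []      = refl
does-any? P? (x ∷ S) = cong (does (P? x) ∨_) (does-any? P? S)

any⇒Any : {A : Set} (f : A → Bool) (S : List A) → any f S ≡ true → Any (λ x → f x ≡ true) S
any⇒Any f (x ∷ S) e with f x in fx
... | true  = here fx
... | false = there (any⇒Any f S e)

Any⇒any : {A : Set} (f : A → Bool) {S : List A} → Any (λ x → f x ≡ true) S → any f S ≡ true
Any⇒any f {x ∷ S} (here fx) rewrite fx = refl
Any⇒any f {x ∷ S} (there a) rewrite Any⇒any f a = ∨-zeroʳ (f x)

isMember : ∀ {m} → List (Fin m) → Fin m → Bool
isMember S c = any (λ c′ → toℕ c′ ≡ᵇ toℕ c) S

isMember⇒∈ : ∀ {m} (S : List (Fin m)) c → isMember S c ≡ true → c ∈ S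
isMember⇒∈ S c e = Any.map (λ e′ → sym (toℕ-injective (≡ᵇ-true⇒≡ _ _ e′))) (any⇒Any _ S e)

count-isMember : ∀ {m} (S : List (Fin m)) → Unique S → count (isMember S) ≡ length S
count-isMember {m} []      _            = sum-replicate-zero m
count-isMember {m} (x ∷ S) (x∉S ∷ uniq) = begin
  count {m} (λ c → (toℕ x ≡ᵇ toℕ c) ∨ isMember S c)
    ≡⟨ count-∨ {m} (λ c → toℕ x ≡ᵇ toℕ c) (isMember S) disjoint ⟩
  count {m} (λ c → toℕ x ≡ᵇ toℕ c) + count (isMember S)
    ≡⟨ cong₂ _+_ (sumRange-𝟙≡ᵇˡ m (toℕ x) (toℕ<n x)) (count-isMember S uniq) ⟩
  suc (length S) ∎
  where
  open ≡-Reasoning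
  x∉S′ : ¬ x ∈ S
  x∉S′ = All¬⇒¬Any x∉S
  disjoint : ∀ c → (toℕ x ≡ᵇ toℕ c) ∧ isMember S c ≡ false
  disjoint c with toℕ x ≡ᵇ toℕ c in x≡c | isMember S c in c∈S
  ... | false | _     = refl
  ... | true  | false = refl
  ... | true  | true  = ⊥-elim (x∉S′ (subst (_∈ S) (sym (toℕ-injective (≡ᵇ-true⇒≡ _ _ x≡c))) (isMember⇒∈ S c c∈S)))

-- Enumerating permutations

infix 4 _≈ₚ_

_≈ₚ_ : ∀ {N} → Permutation′ N → Permutation′ N → Set
π ≈ₚ σ = ∀ i → π ⟨$⟩ʳ i ≡ σ ⟨$⟩ʳ i

permutations : ∀ N → List (Permutation′ N)
permutations zero    = [ Perm.id ]
permutations (suc N) = concat (tabulate λ j → map (insert zero j) (permutations N))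

permutations-complete : ∀ N (π : Permutation′ N) → Any (π ≈ₚ_) (permutations N)
permutations-complete zero    π = here (λ ())
permutations-complete (suc N) π =
  concat⁺ (tabulate⁺ {f = λ j → map (insert zero j) (permutations N)} j (map⁺ (Any.map π≈insert (permutations-complete N (remove zero π)))))
  where
  j = π ⟨$⟩ʳ zero
  π≈insert : ∀ {σ} → remove zero π ≈ₚ σ → π ≈ₚ insert zero j σ
  π≈insert e zero        = refl
  π≈insert {σ} e (suc i) = begin
    π ⟨$⟩ʳ suc i                                ≡⟨ Perm.insert-remove zero π (suc i) ⟨
    insert zero j (remove zero π) ⟨$⟩ʳ suc i    ≡⟨ Perm.insert-punchIn zero j (remove zero π) i ⟩
    punchIn j (remove zero π ⟨$⟩ʳ i)            ≡⟨ cong (punchIn j) (e i) ⟩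
    punchIn j (σ ⟨$⟩ʳ i)                        ≡⟨ Perm.insert-punchIn zero j σ i ⟨
    insert zero j σ ⟨$⟩ʳ suc i                  ∎
    where open ≡-Reasoning

allᵇ : ∀ {N} → (Fin N → Bool) → Bool
allᵇ {zero}  p = true
allᵇ {suc N} p = p zero ∧ allᵇ (p ∘ suc)

allᵇ-cong : ∀ {N} {p q : Fin N → Bool} → (∀ i → p i ≡ q i) → allᵇ p ≡ allᵇ q
allᵇ-cong {zero}  p≡q = refl
allᵇ-cong {suc N} p≡q = cong₂ _∧_ (p≡q zero) (allᵇ-cong (p≡q ∘ suc))

allᵇ-true : ∀ {N} (p : Fin N → Bool) → (∀ i → p i ≡ true) → allᵇ p ≡ true
allᵇ-true {zero}  p all = refl
allᵇ-true {suc N} p all rewrite all zero = allᵇ-true (p ∘ suc) (all ∘ suc)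

mapsInto : ∀ {N} → (Fin N → Bool) → (Fin N → Bool) → Permutation′ N → Bool
mapsInto B C σ = allᵇ (λ i → not (B i) ∨ C (σ ⟨$⟩ʳ i))

mapsInto-insert : ∀ {N} (B C : Fin (suc N) → Bool) j σ →
  mapsInto B C (insert zero j σ) ≡ (not (B zero) ∨ C j) ∧ mapsInto (B ∘ suc) (C ∘ punchIn j) σ
mapsInto-insert B C j σ = cong ((not (B zero) ∨ C j) ∧_)
  (allᵇ-cong λ i → cong (λ x → not (B (suc i)) ∨ C x) (Perm.insert-punchIn zero j σ i))

fall : ℕ → ℕ → ℕ
fall c zero    = 1
fall c (suc b) = c * fall (c ∸ 1) b

fall-suc : ∀ c b → c * fall (c ∸ 1) b ≡ fall c b * (c ∸ b)
fall-suc c       zero    = trans (*-identityʳ c) (sym (+-identityʳ c))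
fall-suc zero    (suc b) = refl
fall-suc (suc c) (suc b) = begin
  suc c * (c * fall (c ∸ 1) b)   ≡⟨ cong (suc c *_) (fall-suc c b) ⟩
  suc c * (fall c b * (c ∸ b))   ≡⟨ *-assoc (suc c) (fall c b) (c ∸ b) ⟨
  suc c * fall c b * (c ∸ b)     ∎
  where open ≡-Reasoning

fall-zero : ∀ c b → c < b → fall c b ≡ 0
fall-zero zero    (suc b) _         = refl
fall-zero (suc c) (suc b) (s≤s c<b) = trans (cong (suc c *_) (fall-zero c b c<b)) (*-zeroʳ (suc c))

fall*[c∸b+d]≤fall*[N∸b] : ∀ {N} c d b → c + d ≡ N → fall c b * ((c ∸ b) + d) ≤ fall c b * (N ∸ b)
fall*[c∸b+d]≤fall*[N∸b] {N} c d b c+d≡N with b ≤? c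
... | no  b≰c rewrite fall-zero c b (≰⇒> b≰c) = z≤n
... | yes b≤c = ≤-reflexive (cong (fall c b *_) (begin
  (c ∸ b) + d            ≡⟨ cong ((c ∸ b) +_) (trans (sym (m+n∸m≡n c d)) (cong (_∸ c) c+d≡N)) ⟩
  (c ∸ b) + (N ∸ c)      ≡⟨ +-∸-comm (N ∸ c) b≤c ⟨
  (c + (N ∸ c)) ∸ b      ≡⟨ cong (_∸ b) (m+[n∸m]≡n (≤-trans (m≤m+n c d) (≤-reflexive c+d≡N))) ⟩
  N ∸ b                  ∎))
  where open ≡-Reasoning

countL-mapsInto-suc : ∀ {N} (B C : Fin (suc N) → Bool) →
  countL (mapsInto B C) (permutations (suc N))
    ≡ ∑[ j < suc N ] (𝟙 (not (B zero) ∨ C j) * countL (mapsInto (B ∘ suc) (C ∘ punchIn j)) (permutations N))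
countL-mapsInto-suc {N} B C = trans (countL-concat-tabulate (mapsInto B C) (λ j → map (insert zero j) (permutations N))) (sum-cong-≗ λ j → begin
  countL (mapsInto B C) (map (insert zero j) (permutations N))
    ≡⟨ countL-map (mapsInto B C) (insert zero j) (permutations N) ⟩
  countL (mapsInto B C ∘ insert zero j) (permutations N)
    ≡⟨ countL-cong (permutations N) (mapsInto-insert B C j) ⟩
  countL (λ σ → (not (B zero) ∨ C j) ∧ mapsInto (B ∘ suc) (C ∘ punchIn j) σ) (permutations N)
    ≡⟨ countL-∧ˡ (not (B zero) ∨ C j) (mapsInto (B ∘ suc) (C ∘ punchIn j)) (permutations N) ⟩
  𝟙 (not (B zero) ∨ C j) * countL (mapsInto (B ∘ suc) (C ∘ punchIn j)) (permutations N) ∎)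
  where open ≡-Reasoning

∑[𝟙*fall]≤fall : ∀ N (C : Fin (suc N) → Bool) b β → b ≤ N →
  ∑[ j < suc N ] (𝟙 (not β ∨ C j) * (fall (count C ∸ 𝟙 (C j)) b * (N ∸ b) !))
    ≤ fall (count C) (𝟙 β + b) * (suc N ∸ (𝟙 β + b)) !
∑[𝟙*fall]≤fall N C b true b≤N = ≤-reflexive (begin
  ∑[ j < suc N ] (𝟙 (C j) * (fall (c ∸ 𝟙 (C j)) b * X))
    ≡⟨ ∑-bool C (λ γ → 𝟙 γ * (fall (c ∸ 𝟙 γ) b * X)) ⟩
  c * (1 * (fall (c ∸ 1) b * X)) + c̄ * 0
    ≡⟨ rearrange c (fall (c ∸ 1) b) X c̄ ⟩
  c * fall (c ∸ 1) b * X ∎)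
  where
  open ≡-Reasoning
  c = count C
  c̄ = count (not ∘ C)
  X = (N ∸ b) !
  rearrange : ∀ c f x d → c * (1 * (f * x)) + d * 0 ≡ c * f * x
  rearrange = solve-∀
∑[𝟙*fall]≤fall N C b false b≤N = begin
  ∑[ j < suc N ] (1 * (fall (c ∸ 𝟙 (C j)) b * X))
    ≡⟨ ∑-bool C (λ γ → 1 * (fall (c ∸ 𝟙 γ) b * X)) ⟩
  c * (1 * (fall (c ∸ 1) b * X)) + c̄ * (1 * (fall c b * X))
    ≡⟨ rearrange c (fall (c ∸ 1) b) X c̄ (fall c b) ⟩
  (c * fall (c ∸ 1) b + c̄ * fall c b) * X
    ≡⟨ cong (λ z → (z + c̄ * fall c b) * X) (fall-suc c b) ⟩
  (fall c b * (c ∸ b) + c̄ * fall c b) * X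
    ≡⟨ factor (fall c b) (c ∸ b) c̄ X ⟩
  fall c b * ((c ∸ b) + c̄) * X
    ≤⟨ *-monoˡ-≤ X (fall*[c∸b+d]≤fall*[N∸b] c c̄ b (count+count-not C)) ⟩
  fall c b * (suc N ∸ b) * X
    ≡⟨ *-assoc (fall c b) _ X ⟩
  fall c b * ((suc N ∸ b) * X)
    ≡⟨ cong (fall c b *_) (trans (cong (_* X) [1+N]∸b≡1+[N∸b]) (cong _! (sym [1+N]∸b≡1+[N∸b]))) ⟩
  fall c b * (suc N ∸ b) ! ∎
  where
  open ≤-Reasoning
  c = count C
  c̄ = count (not ∘ C)
  X = (N ∸ b) !
  rearrange : ∀ c f x d g → c * (1 * (f * x)) + d * (1 * (g * x)) ≡ (c * f + d * g) * x
  rearrange = solve-∀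
  [1+N]∸b≡1+[N∸b] : suc N ∸ b ≡ suc (N ∸ b)
  [1+N]∸b≡1+[N∸b] = +-∸-assoc 1 b≤N
  factor : ∀ f a d x → (f * a + d * f) * x ≡ f * (a + d) * x
  factor = solve-∀

-- If the first point lies in B, its image j must lie in C, and the remaining
-- points of B must then go into C minus j.
count-mapsInto : ∀ N (B C : Fin N → Bool) →
  countL (mapsInto B C) (permutations N) ≤ fall (count C) (count B) * (N ∸ count B) !
count-mapsInto zero    B C = ≤-refl
count-mapsInto (suc N) B C = begin
  countL (mapsInto B C) (permutations (suc N))
    ≡⟨ countL-mapsInto-suc B C ⟩
  ∑[ j < suc N ] (𝟙 (not (B zero) ∨ C j) * countL (mapsInto (B ∘ suc) (C ∘ punchIn j)) (permutations N))
    ≤⟨ ∑-mono-≤ (λ j → *-monoʳ-≤ (𝟙 (not (B zero) ∨ C j)) (count-mapsInto N (B ∘ suc) (C ∘ punchIn j))) ⟩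
  ∑[ j < suc N ] (𝟙 (not (B zero) ∨ C j) * (fall (count (C ∘ punchIn j)) b * X))
    ≡⟨ sum-cong-≗ (λ j → cong (λ z → 𝟙 (not (B zero) ∨ C j) * (fall z b * X)) (count-punchIn C j)) ⟩
  ∑[ j < suc N ] (𝟙 (not (B zero) ∨ C j) * (fall (count C ∸ 𝟙 (C j)) b * X))
    ≤⟨ ∑[𝟙*fall]≤fall N C b (B zero) (count≤ (B ∘ suc)) ⟩
  fall (count C) (count B) * (suc N ∸ count B) ! ∎
  where
  open ≤-Reasoning
  b = count (B ∘ suc)
  X = (N ∸ b) !

-- Subsets of a prescribed size

lookupℕ : ∀ {k} → Vec Bool k → ℕ → Bool
lookupℕ []      y       = false
lookupℕ (b ∷ v) zero    = b
lookupℕ (b ∷ v) (suc y) = lookupℕ v y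

size : ∀ {k} → Vec Bool k → ℕ
size []      = 0
size (b ∷ v) = 𝟙 b + size v

size≤ : ∀ {k} (v : Vec Bool k) → size v ≤ k
size≤ []      = z≤n
size≤ (b ∷ v) = +-mono-≤ (𝟙≤1 b) (size≤ v)

infix 4 _⊆ᵇ_

_⊆ᵇ_ : ∀ {k} → Vec Bool k → Vec Bool k → Set
v ⊆ᵇ w = ∀ y → lookupℕ v y ≡ true → lookupℕ w y ≡ true

lookupℕ-tabulate : ∀ {k} (f : Fin k → Bool) (i : Fin k) → lookupℕ (Vec.tabulate f) (toℕ i) ≡ f i
lookupℕ-tabulate f zero    = refl
lookupℕ-tabulate f (suc i) = lookupℕ-tabulate (f ∘ suc) i

lookupℕ-tabulate-fromℕ< : ∀ {k} (f : Fin k → Bool) {y} (y<k : y < k) → lookupℕ (Vec.tabulate f) y ≡ f (fromℕ< y<k)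
lookupℕ-tabulate-fromℕ< f y<k = trans (cong (lookupℕ (Vec.tabulate f)) (sym (toℕ-fromℕ< y<k))) (lookupℕ-tabulate f _)

size-tabulate : ∀ {k} (f : Fin k → Bool) → size (Vec.tabulate f) ≡ count f
size-tabulate {zero}  f = refl
size-tabulate {suc k} f = cong (𝟙 (f zero) +_) (size-tabulate (f ∘ suc))

sumRange-lookupℕ : ∀ {k} (v : Vec Bool k) → sumRange (λ y → 𝟙 (lookupℕ v y)) k ≡ size v
sumRange-lookupℕ []      = refl
sumRange-lookupℕ (b ∷ v) = cong (𝟙 b +_) (sumRange-lookupℕ v)

enlarge : ∀ {k} (v : Vec Bool k) u → size v ≤ u → u ≤ k → Σ[ w ∈ Vec Bool k ] (size w ≡ u × v ⊆ᵇ w)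
enlarge [] zero _ _ = [] , refl , λ _ ()
enlarge (true ∷ v) (suc u) (s≤s v≤u) (s≤s u≤k) with enlarge v u v≤u u≤k
... | w , ∣w∣≡u , v⊆w = true ∷ w , cong suc ∣w∣≡u , λ { zero _ → refl ; (suc y) p → v⊆w y p }
enlarge {suc k} (false ∷ v) u v≤u u≤1+k with u ≤? k
... | yes u≤k with enlarge v u v≤u u≤k
...   | w , ∣w∣≡u , v⊆w = false ∷ w , ∣w∣≡u , λ { zero () ; (suc y) p → v⊆w y p }
enlarge {suc k} (false ∷ v) u v≤u u≤1+k | no u≰k with enlarge v k (size≤ v) ≤-refl
...   | w , ∣w∣≡k , v⊆w = true ∷ w , trans (cong suc ∣w∣≡k) (≤-antisym (≰⇒> u≰k) u≤1+k) , λ { zero () ; (suc y) p → v⊆w y p }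

subsetsOfSize : ∀ (k s : ℕ) → List (Vec Bool k)
subsetsOfSize zero    zero    = [ [] ]
subsetsOfSize zero    (suc s) = []
subsetsOfSize (suc k) zero    = map (false ∷_) (subsetsOfSize k zero)
subsetsOfSize (suc k) (suc s) = map (true ∷_) (subsetsOfSize k s) ++ map (false ∷_) (subsetsOfSize k (suc s))

subsetsOfSize-size : ∀ (k s : ℕ) → All (λ v → size v ≡ s) (subsetsOfSize k s)
subsetsOfSize-size zero    zero    = refl All.∷ All.[]
subsetsOfSize-size zero    (suc s) = All.[]
subsetsOfSize-size (suc k) zero    = All-map⁺ (subsetsOfSize-size k zero)
subsetsOfSize-size (suc k) (suc s) =
  All-++⁺ (All-map⁺ (All.map (cong suc) (subsetsOfSize-size k s))) (All-map⁺ (subsetsOfSize-size k (suc s)))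

subsetsOfSize-complete : ∀ {k} (v : Vec Bool k) → Any (v ≡_) (subsetsOfSize k (size v))
subsetsOfSize-complete []          = here refl
subsetsOfSize-complete (true ∷ v)  = ++⁺ˡ (map⁺ (Any.map (cong (true ∷_)) (subsetsOfSize-complete v)))
subsetsOfSize-complete {suc k} (false ∷ v) = by-size (size v) refl
  where
  ∈-falses : ∀ {s} → size v ≡ s → Any (false ∷ v ≡_) (map (false ∷_) (subsetsOfSize k s))
  ∈-falses ∣v∣≡s = map⁺ (Any.map (cong (false ∷_)) (subst (λ s → Any (v ≡_) (subsetsOfSize k s)) ∣v∣≡s (subsetsOfSize-complete v)))
  by-size : ∀ s → size v ≡ s → Any (false ∷ v ≡_) (subsetsOfSize (suc k) s)
  by-size zero    ∣v∣≡s = ∈-falses ∣v∣≡s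
  by-size (suc s) ∣v∣≡s = ++⁺ʳ _ (∈-falses ∣v∣≡s)

k^[1+s]+[1+s]*k^s≤[1+k]^[1+s] : ∀ k s → k ^ suc s + suc s * k ^ s ≤ suc k ^ suc s
k^[1+s]+[1+s]*k^s≤[1+k]^[1+s] k zero    = ≤-reflexive (k*1+1*1≡[1+k]*1 k)
  where
  k*1+1*1≡[1+k]*1 : ∀ k → k * 1 + 1 * 1 ≡ (1 + k) * 1
  k*1+1*1≡[1+k]*1 = solve-∀
k^[1+s]+[1+s]*k^s≤[1+k]^[1+s] k (suc s) = begin
  k ^ suc (suc s) + suc (suc s) * k ^ suc s
    ≤⟨ m≤m+n _ (suc s * k ^ s) ⟩
  k * (k * x) + suc (suc s) * (k * x) + suc s * x
    ≡⟨ factor k x s ⟩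
  suc k * (k ^ suc s + suc s * k ^ s)
    ≤⟨ *-monoʳ-≤ (suc k) (k^[1+s]+[1+s]*k^s≤[1+k]^[1+s] k s) ⟩
  suc k ^ suc (suc s) ∎
  where
  open ≤-Reasoning
  x = k ^ s
  factor : ∀ k x s → k * (k * x) + (2 + s) * (k * x) + (1 + s) * x ≡ (1 + k) * (k * x + (1 + s) * x)
  factor = solve-∀

length-subsetsOfSize : ∀ (k s : ℕ) → length (subsetsOfSize k s) * s ! ≤ k ^ s
length-subsetsOfSize zero    zero    = ≤-refl
length-subsetsOfSize zero    (suc s) = z≤n
length-subsetsOfSize (suc k) zero    =
  ≤-trans (≤-reflexive (cong (_* 1) (length-map (false ∷_) (subsetsOfSize k zero)))) (length-subsetsOfSize k zero)
length-subsetsOfSize (suc k) (suc s) = begin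
  length (map (true ∷_) (subsetsOfSize k s) ++ map (false ∷_) (subsetsOfSize k (suc s))) * (suc s * s !)
    ≡⟨ cong (_* (suc s * s !)) (trans (length-++ (map (true ∷_) (subsetsOfSize k s)))
         (cong₂ _+_ (length-map (true ∷_) (subsetsOfSize k s)) (length-map (false ∷_) (subsetsOfSize k (suc s))))) ⟩
  (A + B) * (suc s * s !)
    ≡⟨ rearrange A B (suc s) (s !) ⟩
  B * (suc s * s !) + suc s * (A * s !)
    ≤⟨ +-mono-≤ (length-subsetsOfSize k (suc s)) (*-monoʳ-≤ (suc s) (length-subsetsOfSize k s)) ⟩
  k ^ suc s + suc s * k ^ s
    ≤⟨ k^[1+s]+[1+s]*k^s≤[1+k]^[1+s] k s ⟩
  suc k ^ suc s ∎
  where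
  open ≤-Reasoning
  A = length (subsetsOfSize k s)
  B = length (subsetsOfSize k (suc s))
  rearrange : ∀ a b c d → (a + b) * (c * d) ≡ b * (c * d) + c * (a * d)
  rearrange = solve-∀

odd : ℕ → Bool
odd y = y % 2 ≡ᵇ 1

∑odd≤∑ : {A : Set} (x : A → ℕ) (S : List A) → sum (map (λ c → 𝟙 (odd (x c))) S) ≤ sum (map x S)
∑odd≤∑ x []      = z≤n
∑odd≤∑ x (c ∷ S) = +-mono-≤ (𝟙odd≤ (x c)) (∑odd≤∑ x S)
  where
  𝟙odd≤ : ∀ y → 𝟙 (odd y) ≤ y
  𝟙odd≤ zero    = z≤n
  𝟙odd≤ (suc y) = ≤-trans (𝟙≤1 (odd (suc y))) (s≤s z≤n)

-- For one variable, with multiplicities x c towards the checks c ∈ S: the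
-- touched variable pays for itself by one unit of the total multiplicity.
∑odd+touched≤anyOdd+∑ : {A : Set} (x : A → ℕ) (S : List A) →
  sum (map (λ c → 𝟙 (odd (x c))) S) + 𝟙 (any (λ c → 0 <ᵇ x c) S) ≤ 𝟙 (any (λ c → odd (x c)) S) + sum (map x S)
∑odd+touched≤anyOdd+∑ x []      = z≤n
∑odd+touched≤anyOdd+∑ x (c ∷ S) with x c
... | zero  = ∑odd+touched≤anyOdd+∑ x S
... | suc y = touched (odd (suc y)) (∑odd≤∑ x S)
  where
  touched : ∀ o {D E} → D ≤ E → 𝟙 o + D + 1 ≤ 𝟙 (o ∨ any (λ c → odd (x c)) S) + (suc y + E)
  touched true  {D} {E} D≤E = s≤s (≤-trans (≤-reflexive (+-comm D 1)) (s≤s (≤-trans D≤E (m≤n+m E y))))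
  touched false {D} {E} D≤E = ≤-trans (≤-reflexive (+-comm D 1)) (≤-trans (s≤s (≤-trans D≤E (m≤n+m E y))) (m≤n+m _ _))

-- The configuration model

module ConfigurationModel (dv dc n m : ℕ) .{{_ : NonZero dv}} .{{_ : NonZero dc}} (balanced : n * dv ≡ m * dc) where

  Sockets′ : Set
  Sockets′ = Sockets dv dc n m

  joins : Sockets′ → Fin n → Fin m → Fin (n * dv) → Bool
  joins π v c i = (toℕ i / dv ≡ᵇ toℕ v) ∧ (toℕ (π ⟨$⟩ʳ i) / dc ≡ᵇ toℕ c)

  touched : Sockets′ → List (Fin m) → Fin n → Bool
  touched π S v = any (λ c → 0 <ᵇ multiplicity dv dc n m π v c) S

  variable< : ∀ (i : Fin (n * dv)) → toℕ i / dv < n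
  variable< i = m<n*o⇒m/o<n (toℕ<n i)

  check< : ∀ (j : Fin (n * dv)) → toℕ j / dc < m
  check< j = m<n*o⇒m/o<n (subst (toℕ j <_) balanced (toℕ<n j))

  multiplicity≡count : ∀ π v c → multiplicity dv dc n m π v c ≡ count (joins π v c)
  multiplicity≡count π v c = length-filter-tabulate {n * dv} _ (λ i → i)

  degree≡count : ∀ π c → degree dv dc n m π c ≡ count (λ v → odd (multiplicity dv dc n m π v c))
  degree≡count π c = length-filter-tabulate {n} _ (λ v → v)

  unionSize≡count : ∀ π S → unionSize dv dc n m π S ≡ count (λ v → any (λ c → odd (multiplicity dv dc n m π v c)) S)
  unionSize≡count π S = trans (length-filter-tabulate {n} _ (λ v → v)) (sum-cong-≗ {n} (λ v → cong 𝟙 (does-any? _ S)))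

  ∑-multiplicity≡dc : ∀ π c → ∑[ v < n ] multiplicity dv dc n m π v c ≡ dc
  ∑-multiplicity≡dc π c = begin
    ∑[ v < n ] multiplicity dv dc n m π v c
      ≡⟨ sum-cong-≗ (λ v → multiplicity≡count π v c) ⟩
    ∑[ v < n ] count (joins π v c)
      ≡⟨ ∑-comm (λ v i → 𝟙 (joins π v c i)) ⟩
    ∑[ i < n * dv ] ∑[ v < n ] 𝟙 (joins π v c i)
      ≡⟨ sum-cong-≗ socket-counted-once ⟩
    ∑[ i < n * dv ] 𝟙 (toℕ (π ⟨$⟩ʳ i) / dc ≡ᵇ toℕ c)
      ≡⟨ sum-permute (λ j → 𝟙 (toℕ j / dc ≡ᵇ toℕ c)) π ⟨
    sumRange (λ y → 𝟙 (y / dc ≡ᵇ toℕ c)) (n * dv)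
      ≡⟨ cong (sumRange (λ y → 𝟙 (y / dc ≡ᵇ toℕ c))) balanced ⟩
    sumRange (λ y → 𝟙 (y / dc ≡ᵇ toℕ c)) (m * dc)
      ≡⟨ sumRange-blocks dc (λ y → 𝟙 (y ≡ᵇ toℕ c)) m ⟩
    dc * sumRange (λ y → 𝟙 (y ≡ᵇ toℕ c)) m
      ≡⟨ cong (dc *_) (sumRange-𝟙≡ᵇʳ m (toℕ c) (toℕ<n c)) ⟩
    dc * 1
      ≡⟨ *-identityʳ dc ⟩
    dc ∎
    where
    open ≡-Reasoning
    socket-counted-once : ∀ i → ∑[ v < n ] 𝟙 (joins π v c i) ≡ 𝟙 (toℕ (π ⟨$⟩ʳ i) / dc ≡ᵇ toℕ c)
    socket-counted-once i = begin
      ∑[ v < n ] 𝟙 (joins π v c i)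
        ≡⟨ sum-cong-≗ {n} (λ v → 𝟙-∧ (toℕ i / dv ≡ᵇ toℕ v) b) ⟩
      ∑[ v < n ] (𝟙 (toℕ i / dv ≡ᵇ toℕ v) * 𝟙 b)
        ≡⟨ *-distribʳ-sum {n} (𝟙 b) (λ v → 𝟙 (toℕ i / dv ≡ᵇ toℕ v)) ⟨
      sumRange (λ y → 𝟙 (toℕ i / dv ≡ᵇ y)) n * 𝟙 b
        ≡⟨ cong (_* 𝟙 b) (sumRange-𝟙≡ᵇˡ n (toℕ i / dv) (variable< i)) ⟩
      1 * 𝟙 b
        ≡⟨ *-identityˡ (𝟙 b) ⟩
      𝟙 b ∎
      where b = toℕ (π ⟨$⟩ʳ i) / dc ≡ᵇ toℕ c

  ∑degree+touched≤union+dc*|S| : ∀ π S →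
    sum (map (degree dv dc n m π) S) + count (touched π S) ≤ unionSize dv dc n m π S + length S * dc
  ∑degree+touched≤union+dc*|S| π S = begin
    sum (map (degree dv dc n m π) S) + count (touched π S)
      ≡⟨ cong (_+ count (touched π S)) (trans (cong sum (map-cong (degree≡count π) S)) (sum-map-∑ S (λ c v → 𝟙 (odd (x v c))))) ⟩
    ∑[ v < n ] sum (map (λ c → 𝟙 (odd (x v c))) S) + count (touched π S)
      ≡⟨ ∑-distrib-+ (λ v → sum (map (λ c → 𝟙 (odd (x v c))) S)) (𝟙 ∘ touched π S) ⟨
    ∑[ v < n ] (sum (map (λ c → 𝟙 (odd (x v c))) S) + 𝟙 (touched π S v))
      ≤⟨ ∑-mono-≤ (λ v → ∑odd+touched≤anyOdd+∑ (x v) S) ⟩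
    ∑[ v < n ] (𝟙 (any (λ c → odd (x v c)) S) + sum (map (x v) S))
      ≡⟨ ∑-distrib-+ (λ v → 𝟙 (any (λ c → odd (x v c)) S)) (λ v → sum (map (x v) S)) ⟩
    count (λ v → any (λ c → odd (x v c)) S) + ∑[ v < n ] sum (map (x v) S)
      ≡⟨ cong₂ _+_ (sym (unionSize≡count π S)) edges ⟩
    unionSize dv dc n m π S + length S * dc ∎
    where
    open ≤-Reasoning
    x : Fin n → Fin m → ℕ
    x = multiplicity dv dc n m π
    edges : ∑[ v < n ] sum (map (x v) S) ≡ length S * dc
    edges = trans (sym (sum-map-∑ S (λ c v → x v c)))
                  (trans (cong sum (map-cong (∑-multiplicity≡dc π) S)) (sum-map-const S dc))

  memberVector : List (Fin m) → Vec Bool m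
  memberVector S = Vec.tabulate (isMember S)

  touchedVector : Sockets′ → List (Fin m) → Vec Bool n
  touchedVector π S = Vec.tabulate (touched π S)

  checkSockets : Vec Bool m → Fin (n * dv) → Bool
  checkSockets T j = lookupℕ T (toℕ j / dc)

  variableSockets : Vec Bool n → Fin (n * dv) → Bool
  variableSockets W i = lookupℕ W (toℕ i / dv)

  count-checkSockets : ∀ T → count (checkSockets T) ≡ dc * size T
  count-checkSockets T = begin
    sumRange (λ y → 𝟙 (lookupℕ T (y / dc))) (n * dv)   ≡⟨ cong (sumRange (λ y → 𝟙 (lookupℕ T (y / dc)))) balanced ⟩
    sumRange (λ y → 𝟙 (lookupℕ T (y / dc))) (m * dc)   ≡⟨ sumRange-blocks dc (λ y → 𝟙 (lookupℕ T y)) m ⟩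
    dc * sumRange (λ y → 𝟙 (lookupℕ T y)) m           ≡⟨ cong (dc *_) (sumRange-lookupℕ T) ⟩
    dc * size T                                      ∎
    where open ≡-Reasoning

  count-variableSockets : ∀ W → count (variableSockets W) ≡ dv * size W
  count-variableSockets W = trans (sumRange-blocks dv (λ y → 𝟙 (lookupℕ W y)) n) (cong (dv *_) (sumRange-lookupℕ W))

  Confines : Sockets′ → Vec Bool m → Vec Bool n → Set
  Confines π T W = ∀ i → checkSockets T (π ⟨$⟩ʳ i) ≡ true → variableSockets W i ≡ true

  Confines-⊆ : ∀ {π T W W′} → W ⊆ᵇ W′ → Confines π T W → Confines π T W′
  Confines-⊆ W⊆W′ confined i j∈T = W⊆W′ _ (confined i j∈T)

  touched-confines : ∀ π S → Confines π (memberVector S) (touchedVector π S)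
  touched-confines π S i πi∈S = trans (lookupℕ-tabulate-fromℕ< (touched π S) (variable< i))
    (Any⇒any (λ c → 0 <ᵇ multiplicity dv dc n m π v c) (Any.map joined (isMember⇒∈ S c c∈S)))
    where
    c = fromℕ< (check< (π ⟨$⟩ʳ i))
    v = fromℕ< (variable< i)
    c∈S : isMember S c ≡ true
    c∈S = trans (sym (lookupℕ-tabulate-fromℕ< (isMember S) (check< (π ⟨$⟩ʳ i)))) πi∈S
    i-joins : joins π v c i ≡ true
    i-joins rewrite ≡⇒≡ᵇ-true (sym (toℕ-fromℕ< (variable< i))) | ≡⇒≡ᵇ-true (sym (toℕ-fromℕ< (check< (π ⟨$⟩ʳ i)))) = refl
    joined : ∀ {c′} → c ≡ c′ → (0 <ᵇ multiplicity dv dc n m π v c′) ≡ true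
    joined refl = Equivalence.to T-≡ (<⇒<ᵇ (subst (1 ≤_) (sym (multiplicity≡count π v c)) (count-pos (joins π v c) i i-joins)))

  Confines⇒mapsInto : ∀ {π T W} → Confines π T W → mapsInto (checkSockets T) (variableSockets W) (flip π) ≡ true
  Confines⇒mapsInto {π} {T} {W} confined = allᵇ-true _ λ j → lemma j
    where
    lemma : ∀ j → not (checkSockets T j) ∨ variableSockets W (π ⟨$⟩ˡ j) ≡ true
    lemma j with checkSockets T j in j∈T
    ... | false = refl
    ... | true  = confined (π ⟨$⟩ˡ j) (trans (cong (checkSockets T) (Perm.inverseʳ π)) j∈T)

  module Cover (u : ℕ → ℕ) where

    -- mapsInto is applied to the inverse permutation, from check sockets to variable sockets.
    confinedTo : Vec Bool m → Vec Bool n → List Sockets′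
    confinedTo T W = map flip (filterᵇ (mapsInto (checkSockets T) (variableSockets W)) (permutations (n * dv)))

    confinedAt : ℕ → List Sockets′
    confinedAt s = concatMap (λ T → concatMap (confinedTo T) (subsetsOfSize n (u s))) (subsetsOfSize m s)

    confinedUpTo : ℕ → List Sockets′
    confinedUpTo zero    = []
    confinedUpTo (suc k) = confinedAt (suc k) ++ confinedUpTo k

    ∈-confinedTo : ∀ π T W → Confines π T W → Any (SamePerm dv dc n m π) (confinedTo T W)
    ∈-confinedTo π T W confined = map⁺ (Any.map (λ {σ} → flip-≈ {σ}) (Any-filterᵇ⁺ (mapsInto (checkSockets T) (variableSockets W)) (λ {σ} → mapsInto-≈ {σ}) (permutations-complete (n * dv) (flip π))))
      where
      mapsInto-≈ : ∀ {σ} → flip π ≈ₚ σ → mapsInto (checkSockets T) (variableSockets W) σ ≡ true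
      mapsInto-≈ e = trans (allᵇ-cong (λ j → cong (λ k → not (checkSockets T j) ∨ variableSockets W k) (sym (e j))))
                           (Confines⇒mapsInto {π} {T} {W} confined)
      flip-≈ : ∀ {σ} → flip π ≈ₚ σ → SamePerm dv dc n m π (flip σ)
      flip-≈ {σ} e i = sym (trans (cong (σ ⟨$⟩ˡ_) (sym (trans (sym (e (π ⟨$⟩ʳ i))) (Perm.inverseˡ π)))) (Perm.inverseˡ σ))

    ∈-confinedUpTo : ∀ π s T W k → 1 ≤ s → s ≤ k → size T ≡ s → size W ≡ u s →
      Confines π T W → Any (SamePerm dv dc n m π) (confinedUpTo k)
    ∈-confinedUpTo π (suc s) T W zero 1≤s () ∣T∣≡s ∣W∣≡us confined
    ∈-confinedUpTo π s T W (suc k) 1≤s s≤1+k ∣T∣≡s ∣W∣≡us confined with s ≟ suc k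
    ... | yes refl = ++⁺ˡ (concatMap⁺ _ (Any.map (λ { refl → concatMap⁺ (confinedTo T) (Any.map (λ { refl → ∈-confinedTo π T W confined }) W∈) }) T∈))
      where
      T∈ : Any (T ≡_) (subsetsOfSize m (suc k))
      T∈ = subst (λ s → Any (T ≡_) (subsetsOfSize m s)) ∣T∣≡s (subsetsOfSize-complete T)
      W∈ : Any (W ≡_) (subsetsOfSize n (u (suc k)))
      W∈ = subst (λ s → Any (W ≡_) (subsetsOfSize n s)) ∣W∣≡us (subsetsOfSize-complete W)
    ... | no s≢1+k = ++⁺ʳ (confinedAt (suc k)) (∈-confinedUpTo π s T W k 1≤s (≤-pred (≤∧≢⇒< s≤1+k s≢1+k)) ∣T∣≡s ∣W∣≡us confined)

    confinedCount : ℕ → ℕ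
    confinedCount s = fall (dv * u s) (dc * s) * (n * dv ∸ dc * s) !

    length-confinedTo : ∀ s T W → size T ≡ s → size W ≡ u s → length (confinedTo T W) ≤ confinedCount s
    length-confinedTo s T W ∣T∣≡s ∣W∣≡us = begin
      length (confinedTo T W)
        ≡⟨ trans (length-map flip (filterᵇ B⇒C (permutations (n * dv)))) (length-filterᵇ B⇒C (permutations (n * dv))) ⟩
      countL B⇒C (permutations (n * dv))
        ≤⟨ count-mapsInto (n * dv) (checkSockets T) (variableSockets W) ⟩
      fall (count (variableSockets W)) (count (checkSockets T)) * (n * dv ∸ count (checkSockets T)) !
        ≡⟨ cong₂ (λ a b → fall a b * (n * dv ∸ b) !) (trans (count-variableSockets W) (cong (dv *_) ∣W∣≡us))
                                                      (trans (count-checkSockets T) (cong (dc *_) ∣T∣≡s)) ⟩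
      confinedCount s ∎
      where
      open ≤-Reasoning
      B⇒C = mapsInto (checkSockets T) (variableSockets W)

    confinedBound : ℕ → ℕ
    confinedBound s = length (subsetsOfSize m s) * (length (subsetsOfSize n (u s)) * confinedCount s)

    length-confinedUpTo : ∀ k → length (confinedUpTo k) ≤ sumTo confinedBound k
    length-confinedUpTo zero    = z≤n
    length-confinedUpTo (suc k) = ≤-trans (≤-reflexive (length-++ (confinedAt (suc k))))
      (+-mono-≤ (length-concatMap≤ _ _ (λ {T} ∣T∣≡s →
                   length-concatMap≤ _ _ (λ {W} ∣W∣≡us → length-confinedTo (suc k) T W ∣T∣≡s ∣W∣≡us)
                     (subsetsOfSize-size n (u (suc k))))
                 (subsetsOfSize-size m (suc k)))
                (length-confinedUpTo k))

-- Elementary estimates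

[m*n]^k≡m^k*n^k : ∀ m n k → (m * n) ^ k ≡ m ^ k * n ^ k
[m*n]^k≡m^k*n^k m n zero    = refl
[m*n]^k≡m^k*n^k m n (suc k) = trans (cong ((m * n) *_) ([m*n]^k≡m^k*n^k m n k)) (interchange m n (m ^ k) (n ^ k))
  where
  interchange : ∀ a b x y → a * b * (x * y) ≡ a * x * (b * y)
  interchange = solve-∀

m^s*u^r*4^u*2^k≤n^s*d^s*s^r*c^r*8^k : ∀ n m s u r k d c → m ≤ n * d → u ≤ s * c → u ≤ k →
  m ^ s * u ^ r * 4 ^ u * 2 ^ k ≤ n ^ s * d ^ s * (s ^ r * c ^ r) * 8 ^ k
m^s*u^r*4^u*2^k≤n^s*d^s*s^r*c^r*8^k n m s u r k d c m≤nd u≤sc u≤k = begin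
  m ^ s * u ^ r * 4 ^ u * 2 ^ k
    ≤⟨ *-monoˡ-≤ (2 ^ k) (*-mono-≤ (*-mono-≤ (^-monoˡ-≤ s m≤nd) (^-monoˡ-≤ r u≤sc)) (^-monoʳ-≤ 4 u≤k)) ⟩
  (n * d) ^ s * (s * c) ^ r * 4 ^ k * 2 ^ k
    ≡⟨ *-assoc ((n * d) ^ s * (s * c) ^ r) (4 ^ k) (2 ^ k) ⟩
  (n * d) ^ s * (s * c) ^ r * (4 ^ k * 2 ^ k)
    ≡⟨ cong₂ _*_ (cong₂ _*_ ([m*n]^k≡m^k*n^k n d s) ([m*n]^k≡m^k*n^k s c r)) (sym ([m*n]^k≡m^k*n^k 4 2 k)) ⟩
  n ^ s * d ^ s * (s ^ r * c ^ r) * 8 ^ k ∎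
  where open ≤-Reasoning

1+n≤2^n : ∀ n → suc n ≤ 2 ^ n
1+n≤2^n zero    = ≤-refl
1+n≤2^n (suc n) = +-mono-≤ (m^n>0 2 n) (≤-trans (1+n≤2^n n) (≤-reflexive (sym (+-identityʳ (2 ^ n)))))

fall≤^ : ∀ a k → fall a k ≤ a ^ k
fall≤^ a zero    = ≤-refl
fall≤^ a (suc k) = *-monoʳ-≤ a (≤-trans (fall≤^ (a ∸ 1) k) (^-monoˡ-≤ k (m∸n≤m a 1)))

m!*m^k≤[m+k]! : ∀ m k → m ! * m ^ k ≤ (m + k) !
m!*m^k≤[m+k]! m zero    = ≤-reflexive (trans (*-identityʳ _) (cong _! (sym (+-identityʳ m))))
m!*m^k≤[m+k]! m (suc k) = begin
  m ! * (m * m ^ k)        ≡⟨ x*[y*z]≡y*[x*z] (m !) m (m ^ k) ⟩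
  m * (m ! * m ^ k)        ≤⟨ *-mono-≤ (≤-trans (m≤m+n m k) (n≤1+n (m + k))) (m!*m^k≤[m+k]! m k) ⟩
  suc (m + k) * (m + k) !  ≡⟨ cong _! (+-suc m k) ⟨
  (m + suc k) !            ∎
  where
  open ≤-Reasoning
  x*[y*z]≡y*[x*z] : ∀ x y z → x * (y * z) ≡ y * (x * z)
  x*[y*z]≡y*[x*z] = solve-∀

[m∸k]!*[m∸k]^k≤m! : ∀ m k → (m ∸ k) ! * (m ∸ k) ^ k ≤ m !
[m∸k]!*[m∸k]^k≤m! m k with k ≤? m
... | yes k≤m = ≤-trans (m!*m^k≤[m+k]! (m ∸ k) k) (≤-reflexive (cong _! (m∸n+n≡m k≤m)))
... | no  k≰m = subst (λ z → z ! * z ^ k ≤ m !) (sym (m≤n⇒m∸n≡0 (<⇒≤ (≰⇒> k≰m)))) (0^k≤ k (≰⇒> k≰m))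
  where
  0^k≤ : ∀ k → m < k → 0 ! * 0 ^ k ≤ m !
  0^k≤ (suc k) _ = z≤n

-- A Bernoulli-type inequality, (1 + 1/(j+w))^j ≤ (1 + j + w) / (1 + w), cleared of denominators.
[1+j+w]^j*[1+w]≤[j+w]^j*[1+j+w] : ∀ j w → suc (j + w) ^ j * suc w ≤ (j + w) ^ j * suc (j + w)
[1+j+w]^j*[1+w]≤[j+w]^j*[1+j+w] zero    w = ≤-refl
[1+j+w]^j*[1+w]≤[j+w]^j*[1+j+w] (suc j) w = *-cancelʳ-≤ _ _ (suc (suc w)) (begin
  suc s * A * suc w * suc (suc w)     ≡⟨ regroupˡ (suc s) A (suc w) (suc (suc w)) ⟩
  suc s * suc w * (A * suc (suc w))   ≤⟨ *-mono-≤ [2+s][1+w]≤s[2+w] ih ⟩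
  s * suc (suc w) * (B * suc s)       ≡⟨ regroupʳ s (suc (suc w)) B (suc s) ⟩
  s * B * suc s * suc (suc w)         ∎)
  where
  open ≤-Reasoning
  s = suc (j + w)
  A = suc s ^ j
  B = s ^ j
  ih : A * suc (suc w) ≤ B * suc s
  ih = subst (λ z → suc z ^ j * suc (suc w) ≤ z ^ j * suc z) (+-suc j w) ([1+j+w]^j*[1+w]≤[j+w]^j*[1+j+w] j (suc w))
  [2+s][1+w]≤s[2+w] : suc s * suc w ≤ s * suc (suc w)
  [2+s][1+w]≤s[2+w] = begin
    suc s * suc w       ≡⟨⟩
    suc w + s * suc w   ≤⟨ +-monoˡ-≤ (s * suc w) (s≤s (m≤n+m w j)) ⟩
    s + s * suc w       ≡⟨ *-suc s (suc w) ⟨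
    s * suc (suc w)     ∎
  regroupˡ : ∀ a x b c → a * x * b * c ≡ a * b * (x * c)
  regroupˡ = solve-∀
  regroupʳ : ∀ a c x b → a * c * (x * b) ≡ a * x * b * c
  regroupʳ = solve-∀

[1+j+w]^j≤2*[j+w]^j : ∀ j w → j ≤ suc w → suc (j + w) ^ j ≤ 2 * (j + w) ^ j
[1+j+w]^j≤2*[j+w]^j j w j≤1+w = *-cancelʳ-≤ _ _ (suc w) (begin
  suc (j + w) ^ j * suc w      ≤⟨ [1+j+w]^j*[1+w]≤[j+w]^j*[1+j+w] j w ⟩
  (j + w) ^ j * suc (j + w)    ≤⟨ *-monoʳ-≤ ((j + w) ^ j) 1+j+w≤2[1+w] ⟩
  (j + w) ^ j * (2 * suc w)    ≡⟨ x*[2*y]≡2*x*y ((j + w) ^ j) (suc w) ⟩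
  2 * (j + w) ^ j * suc w      ∎)
  where
  open ≤-Reasoning
  1+j+w≤2[1+w] : suc (j + w) ≤ 2 * suc w
  1+j+w≤2[1+w] = ≤-trans (≤-reflexive (sym (+-suc j w))) (≤-trans (+-monoˡ-≤ (suc w) j≤1+w) (≤-reflexive (cong (suc w +_) (sym (+-identityʳ (suc w))))))
  x*[2*y]≡2*x*y : ∀ x y → x * (2 * y) ≡ 2 * x * y
  x*[2*y]≡2*x*y = solve-∀

halves : ∀ s → ∃₂ λ a b → a + b ≡ s × a ≤ b × b ≤ suc a
halves zero    = 0 , 0 , refl , z≤n , z≤n
halves (suc s) with halves s
... | a , b , a+b≡s , a≤b , b≤1+a = b , suc a , trans (+-suc b a) (cong suc (trans (+-comm b a) a+b≡s)) , b≤1+a , s≤s a≤b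

-- (1 + 1/s)^s ≤ 4, by applying the Bernoulli-type bound to both halves of the exponent.
[1+s]^s≤4*s^s : ∀ s → suc s ^ s ≤ 4 * s ^ s
[1+s]^s≤4*s^s s with halves s
... | a , b , refl , a≤b , b≤1+a = begin
  suc (a + b) ^ (a + b)                  ≡⟨ ^-distribˡ-+-* (suc (a + b)) a b ⟩
  suc (a + b) ^ a * suc (a + b) ^ b      ≤⟨ *-mono-≤ ([1+j+w]^j≤2*[j+w]^j a b (≤-trans a≤b (n≤1+n b)))
                                                      (subst (λ z → suc z ^ b ≤ 2 * z ^ b) (+-comm b a) ([1+j+w]^j≤2*[j+w]^j b a b≤1+a)) ⟩
  (2 * (a + b) ^ a) * (2 * (a + b) ^ b)  ≡⟨ [2x][2y]≡4xy ((a + b) ^ a) ((a + b) ^ b) ⟩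
  4 * ((a + b) ^ a * (a + b) ^ b)        ≡⟨ cong (4 *_) (^-distribˡ-+-* (a + b) a b) ⟨
  4 * (a + b) ^ (a + b)                  ∎
  where
  open ≤-Reasoning
  [2x][2y]≡4xy : ∀ x y → (2 * x) * (2 * y) ≡ 4 * (x * y)
  [2x][2y]≡4xy = solve-∀

n^n≤4^n*n! : ∀ n → n ^ n ≤ 4 ^ n * n !
n^n≤4^n*n! zero    = ≤-refl
n^n≤4^n*n! (suc n) = begin
  suc n * suc n ^ n               ≤⟨ *-monoʳ-≤ (suc n) ([1+s]^s≤4*s^s n) ⟩
  suc n * (4 * n ^ n)             ≤⟨ *-monoʳ-≤ (suc n) (*-monoʳ-≤ 4 (n^n≤4^n*n! n)) ⟩
  suc n * (4 * (4 ^ n * n !))     ≡⟨ regroup (suc n) (4 ^ n) (n !) ⟩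
  4 * 4 ^ n * (suc n * n !)       ∎
  where
  open ≤-Reasoning
  regroup : ∀ a b c → a * (4 * (b * c)) ≡ 4 * b * (a * c)
  regroup = solve-∀

-- Y (1 - 2^-S) bounds the sum when each term is at most Y 2^-s.
sumTo*2^S+Y≤2^S*Y : ∀ (x : ℕ → ℕ) Y S → (∀ s → 1 ≤ s → s ≤ S → x s * 2 ^ s ≤ Y) → sumTo x S * 2 ^ S + Y ≤ 2 ^ S * Y
sumTo*2^S+Y≤2^S*Y x Y zero    bound = ≤-reflexive (sym (+-identityʳ Y))
sumTo*2^S+Y≤2^S*Y x Y (suc S) bound = begin
  (x (suc S) + T) * (2 * 2 ^ S) + Y
    ≡⟨ expand (x (suc S)) T (2 ^ S) Y ⟩
  x (suc S) * (2 * 2 ^ S) + (T * 2 ^ S + (T * 2 ^ S + Y))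
    ≤⟨ +-monoˡ-≤ _ (bound (suc S) (s≤s z≤n) ≤-refl) ⟩
  Y + (T * 2 ^ S + (T * 2 ^ S + Y))
    ≡⟨ regroup Y (T * 2 ^ S) ⟩
  (T * 2 ^ S + Y) + ((T * 2 ^ S + Y) + 0)
    ≤⟨ +-mono-≤ ih (+-monoˡ-≤ 0 ih) ⟩
  2 ^ S * Y + (2 ^ S * Y + 0)
    ≡⟨ *-assoc 2 (2 ^ S) Y ⟨
  2 * 2 ^ S * Y ∎
  where
  open ≤-Reasoning
  T = sumTo x S
  ih : T * 2 ^ S + Y ≤ 2 ^ S * Y
  ih = sumTo*2^S+Y≤2^S*Y x Y S (λ s 1≤s s≤S → bound s 1≤s (≤-trans s≤S (n≤1+n S)))
  expand : ∀ a t p y → (a + t) * (2 * p) + y ≡ a * (2 * p) + (t * p + (t * p + y))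
  expand = solve-∀
  regroup : ∀ y z → y + (z + (z + y)) ≡ (z + y) + ((z + y) + 0)
  regroup = solve-∀

sumTo≤ : ∀ (x : ℕ → ℕ) Y S → (∀ s → 1 ≤ s → s ≤ S → x s * 2 ^ s ≤ Y) → sumTo x S ≤ Y
sumTo≤ x Y S bound = *-cancelʳ-≤ _ _ (2 ^ S) {{m^n≢0 2 S}}
  (≤-trans (m≤m+n _ Y) (≤-trans (sumTo*2^S+Y≤2^S*Y x Y S bound) (≤-reflexive (*-comm (2 ^ S) Y))))

sumTo-*ʳ : ∀ (x : ℕ → ℕ) c S → sumTo (λ s → x s * c) S ≡ sumTo x S * c
sumTo-*ʳ x c zero    = refl
sumTo-*ʳ x c (suc S) = trans (cong (x (suc S) * c +_) (sumTo-*ʳ x c S)) (sym (*-distribʳ-+ c (x (suc S)) (sumTo x S)))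

-- η will be 1 / (1 + H), and C₀ M! / n bounds the number of bad permutations.
module TailBound (dv dc q : ℕ) .{{_ : NonZero dv}} .{{_ : NonZero dc}} .{{_ : NonZero q}} where

  K : ℕ
  K = dv * dc * dc * 8 * 8 ^ dc

  H : ℕ
  H = (2 * K) ^ q

  C₀ : ℕ
  C₀ = dc * q * K ^ q

  instance
    K≢0 : NonZero K
    K≢0 = m*n≢0 (dv * dc * dc * 8) (8 ^ dc) {{m*n≢0 (dv * dc * dc) 8 {{m*n≢0 (dv * dc) dc {{m*n≢0 dv dc}}}}}} {{m^n≢0 8 dc}}

  K^s≡ : ∀ s → K ^ s ≡ dv ^ s * dc ^ s * dc ^ s * 8 ^ s * (8 ^ dc) ^ s
  K^s≡ s = trans ([m*n]^k≡m^k*n^k (dv * dc * dc * 8) (8 ^ dc) s)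
    (cong (_* (8 ^ dc) ^ s) (trans ([m*n]^k≡m^k*n^k (dv * dc * dc) 8 s)
    (cong (_* 8 ^ s) (trans ([m*n]^k≡m^k*n^k (dv * dc) dc s) (cong (_* dc ^ s) ([m*n]^k≡m^k*n^k dv dc s))))))

  K^s*dc*s≤C₀*H^t : ∀ s t → s ≤ q * t + q → K ^ s * dc * s ≤ C₀ * H ^ t
  K^s*dc*s≤C₀*H^t s t s≤qt+q = begin
    K ^ s * dc * s
      ≤⟨ *-mono-≤ (*-monoˡ-≤ dc (^-monoʳ-≤ K s≤qt+q)) s≤q*2^[qt] ⟩
    K ^ (q * t + q) * dc * (q * 2 ^ (q * t))
      ≡⟨ cong (λ z → z * dc * (q * 2 ^ (q * t))) (^-distribˡ-+-* K (q * t) q) ⟩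
    K ^ (q * t) * K ^ q * dc * (q * 2 ^ (q * t))
      ≡⟨ regroup (K ^ (q * t)) (K ^ q) dc q (2 ^ (q * t)) ⟩
    C₀ * (2 ^ (q * t) * K ^ (q * t))
      ≡⟨ cong (C₀ *_) ([m*n]^k≡m^k*n^k 2 K (q * t)) ⟨
    C₀ * (2 * K) ^ (q * t)
      ≡⟨ cong (C₀ *_) (^-*-assoc (2 * K) q t) ⟨
    C₀ * H ^ t ∎
    where
    open ≤-Reasoning
    regroup : ∀ a b c d e → a * b * c * (d * e) ≡ (c * d * b) * (e * a)
    regroup = solve-∀
    s≤q*2^[qt] : s ≤ q * 2 ^ (q * t)
    s≤q*2^[qt] = begin
      s                 ≤⟨ s≤qt+q ⟩
      q * t + q         ≡⟨ +-comm (q * t) q ⟩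
      q + q * t         ≡⟨ *-suc q t ⟨
      q * suc t         ≤⟨ *-monoʳ-≤ q (≤-trans (1+n≤2^n t) (^-monoʳ-≤ 2 (m≤n*m t q))) ⟩
      q * 2 ^ (q * t)   ∎

  dv^s*dc^[s+1+t]*8^s*8^[dc*s]≤K^s*dc : ∀ s t → t ≤ s →
    dv ^ s * dc ^ (s + suc t) * 8 ^ s * 8 ^ (dc * s) ≤ K ^ s * dc
  dv^s*dc^[s+1+t]*8^s*8^[dc*s]≤K^s*dc s t t≤s = begin
    dv ^ s * dc ^ (s + suc t) * 8 ^ s * 8 ^ (dc * s)
      ≤⟨ *-monoˡ-≤ (8 ^ (dc * s)) (*-monoˡ-≤ (8 ^ s) (*-monoʳ-≤ (dv ^ s) (^-monoʳ-≤ dc (+-monoʳ-≤ s (s≤s t≤s))))) ⟩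
    dv ^ s * dc ^ (s + suc s) * 8 ^ s * 8 ^ (dc * s)
      ≡⟨ cong₂ (λ a b → dv ^ s * a * 8 ^ s * b) (^-distribˡ-+-* dc s (suc s)) (sym (^-*-assoc 8 dc s)) ⟩
    dv ^ s * (dc ^ s * (dc * dc ^ s)) * 8 ^ s * (8 ^ dc) ^ s
      ≡⟨ regroup (dv ^ s) (dc ^ s) dc (8 ^ s) ((8 ^ dc) ^ s) ⟩
    dv ^ s * dc ^ s * dc ^ s * 8 ^ s * (8 ^ dc) ^ s * dc
      ≡⟨ cong (_* dc) (K^s≡ s) ⟨
    K ^ s * dc ∎
    where
    open ≤-Reasoning
    regroup : ∀ a c d e f → a * (c * (d * c)) * e * f ≡ a * c * c * e * f * d
    regroup = solve-∀

  dv^s*dc^r*8^s*8^k*s^[1+t]≤C₀*n^t : ∀ n s t → t ≤ s → s ≤ q * t + q → s * H ≤ n →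
    dv ^ s * dc ^ (s + suc t) * 8 ^ s * 8 ^ (dc * s) * s ^ suc t ≤ C₀ * n ^ t
  dv^s*dc^r*8^s*8^k*s^[1+t]≤C₀*n^t n s t t≤s s≤qt+q sH≤n = begin
    dv ^ s * dc ^ (s + suc t) * 8 ^ s * 8 ^ (dc * s) * (s * s ^ t)
      ≡⟨ *-assoc (dv ^ s * dc ^ (s + suc t) * 8 ^ s * 8 ^ (dc * s)) s (s ^ t) ⟨
    dv ^ s * dc ^ (s + suc t) * 8 ^ s * 8 ^ (dc * s) * s * s ^ t
      ≤⟨ *-monoˡ-≤ (s ^ t) (*-monoˡ-≤ s (dv^s*dc^[s+1+t]*8^s*8^[dc*s]≤K^s*dc s t t≤s)) ⟩
    K ^ s * dc * s * s ^ t
      ≤⟨ *-monoˡ-≤ (s ^ t) (K^s*dc*s≤C₀*H^t s t s≤qt+q) ⟩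
    C₀ * H ^ t * s ^ t
      ≡⟨ trans (*-assoc C₀ (H ^ t) (s ^ t)) (cong (C₀ *_) (trans (*-comm (H ^ t) (s ^ t)) (sym ([m*n]^k≡m^k*n^k s H t)))) ⟩
    C₀ * (s * H) ^ t
      ≤⟨ *-monoʳ-≤ C₀ (^-monoˡ-≤ t sH≤n) ⟩
    C₀ * n ^ t ∎
    where open ≤-Reasoning

  m^s*n^u*[dv*u]^k*n*8^s*4^u*2^k≤C₀*s^s*u^u*M^k : ∀ n m s t u → t ≤ s → s ≤ q * t + q → s * H ≤ n →
    m ≤ n * dv → u + (s + suc t) ≡ dc * s →
    m ^ s * n ^ u * (dv * u) ^ (dc * s) * n * 8 ^ s * 4 ^ u * 2 ^ (dc * s)
      ≤ C₀ * s ^ s * u ^ u * (n * dv) ^ (dc * s)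
  m^s*n^u*[dv*u]^k*n*8^s*4^u*2^k≤C₀*s^s*u^u*M^k n m s t u t≤s s≤qt+q sH≤n m≤M u+r≡k = begin
    m ^ s * n ^ u * (dv * u) ^ k * n * 8 ^ s * 4 ^ u * 2 ^ k
      ≡⟨ cong (λ z → m ^ s * n ^ u * z * n * 8 ^ s * 4 ^ u * 2 ^ k) [dv*u]^k≡ ⟩
    m ^ s * n ^ u * (dv ^ k * (u ^ u * u ^ r)) * n * 8 ^ s * 4 ^ u * 2 ^ k
      ≡⟨ regroup₁ (m ^ s) (n ^ u) (dv ^ k) (u ^ u) (u ^ r) n (8 ^ s) (4 ^ u) (2 ^ k) ⟩
    (m ^ s * u ^ r * 4 ^ u * 2 ^ k) * (8 ^ s * n) * rest
      ≤⟨ *-monoˡ-≤ rest (*-monoˡ-≤ (8 ^ s * n) (m^s*u^r*4^u*2^k≤n^s*d^s*s^r*c^r*8^k n m s u r k dv dc m≤M (≤-trans u≤k (≤-reflexive (*-comm dc s))) u≤k)) ⟩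
    (n ^ s * dv ^ s * (s ^ r * dc ^ r) * 8 ^ k) * (8 ^ s * n) * rest
      ≡⟨ cong (λ z → (n ^ s * dv ^ s * (z * dc ^ r) * 8 ^ k) * (8 ^ s * n) * rest) (^-distribˡ-+-* s s (suc t)) ⟩
    (n ^ s * dv ^ s * (s ^ s * s ^ suc t * dc ^ r) * 8 ^ k) * (8 ^ s * n) * rest
      ≡⟨ regroup₂ (n ^ s) (dv ^ s) (s ^ s) (s ^ suc t) (dc ^ r) (8 ^ k) (8 ^ s) n rest ⟩
    (dv ^ s * dc ^ r * 8 ^ s * 8 ^ k * s ^ suc t) * (s ^ s * (n ^ s * n)) * rest
      ≤⟨ *-monoˡ-≤ rest (*-monoˡ-≤ (s ^ s * (n ^ s * n)) (dv^s*dc^r*8^s*8^k*s^[1+t]≤C₀*n^t n s t t≤s s≤qt+q sH≤n)) ⟩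
    C₀ * n ^ t * (s ^ s * (n ^ s * n)) * rest
      ≡⟨ regroup₃ C₀ (n ^ t) (s ^ s) (n ^ s) n (n ^ u) (u ^ u) (dv ^ k) ⟩
    C₀ * s ^ s * u ^ u * (n ^ u * (n ^ s * (n * n ^ t)) * dv ^ k)
      ≡⟨ cong (λ z → C₀ * s ^ s * u ^ u * (z * dv ^ k)) n^u*n^r≡n^k ⟩
    C₀ * s ^ s * u ^ u * (n ^ k * dv ^ k)
      ≡⟨ cong (C₀ * s ^ s * u ^ u *_) ([m*n]^k≡m^k*n^k n dv k) ⟨
    C₀ * s ^ s * u ^ u * (n * dv) ^ k ∎
    where
    open ≤-Reasoning
    k = dc * s
    r = s + suc t
    rest = n ^ u * u ^ u * dv ^ k
    [dv*u]^k≡ : (dv * u) ^ k ≡ dv ^ k * (u ^ u * u ^ r)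
    [dv*u]^k≡ = trans ([m*n]^k≡m^k*n^k dv u k) (cong (dv ^ k *_) (trans (cong (u ^_) (sym u+r≡k)) (^-distribˡ-+-* u u r)))
    n^u*n^r≡n^k : n ^ u * (n ^ s * (n * n ^ t)) ≡ n ^ k
    n^u*n^r≡n^k = trans (cong (n ^ u *_) (sym (^-distribˡ-+-* n s (suc t))))
                        (trans (sym (^-distribˡ-+-* n u r)) (cong (n ^_) u+r≡k))
    u≤k : u ≤ k
    u≤k = ≤-trans (m≤m+n u r) (≤-reflexive u+r≡k)
    regroup₁ : ∀ a b c d e n f g h → a * b * (c * (d * e)) * n * f * g * h ≡ (a * e * g * h) * (f * n) * (b * d * c)
    regroup₁ = solve-∀
    regroup₂ : ∀ a b c d e f g n x → (a * b * (c * d * e) * f) * (g * n) * x ≡ (b * e * g * f * d) * (c * (a * n)) * x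
    regroup₂ = solve-∀
    regroup₃ : ∀ c a b d n e f g → c * a * (b * (d * n)) * (e * f * g) ≡ c * b * f * (e * (d * (n * a)) * g)
    regroup₃ = solve-∀

  2*dc≤H : 2 * dc ≤ H
  2*dc≤H = begin
    2 * dc                        ≤⟨ *-monoʳ-≤ 2 dc≤K ⟩
    2 * K                         ≡⟨ *-identityʳ (2 * K) ⟨
    (2 * K) ^ 1                   ≤⟨ ^-monoʳ-≤ (2 * K) {{m*n≢0 2 K}} (>-nonZero⁻¹ q) ⟩
    H                             ∎
    where
    open ≤-Reasoning
    dc≤K : dc ≤ K
    dc≤K = ≤-trans (m≤n*m dc dv) (≤-trans (m≤m*n (dv * dc) dc) (≤-trans (m≤m*n (dv * dc * dc) 8) (m≤m*n (dv * dc * dc * 8) (8 ^ dc) {{m^n≢0 8 dc}})))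

  module _ (n s : ℕ) .{{_ : NonZero s}} (sH≤n : s * H ≤ n) where

    private
      k = dc * s
      M = n * dv
      D = M ∸ k

    2k≤M : 2 * k ≤ M
    2k≤M = begin
      2 * (dc * s)     ≡⟨ *-assoc 2 dc s ⟨
      2 * dc * s       ≤⟨ *-monoˡ-≤ s 2*dc≤H ⟩
      H * s            ≡⟨ *-comm H s ⟩
      s * H            ≤⟨ sH≤n ⟩
      n                ≤⟨ m≤m*n n dv ⟩
      n * dv           ∎
      where open ≤-Reasoning

    k≤M∸k : k ≤ D
    k≤M∸k = ≤-trans (≤-reflexive (sym (m+n∸n≡m k k))) (∸-monoˡ-≤ k (≤-trans (≤-reflexive (cong (k +_) (sym (+-identityʳ k)))) 2k≤M))

    instance
      D≢0 : NonZero D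
      D≢0 = >-nonZero (≤-trans (>-nonZero⁻¹ k {{m*n≢0 dc s}}) k≤M∸k)

    M≤2*[M∸k] : M ≤ 2 * D
    M≤2*[M∸k] = begin
      M            ≡⟨ m∸n+n≡m (≤-trans k≤M∸k (m∸n≤m M k)) ⟨
      D + k        ≤⟨ +-monoʳ-≤ D (≤-trans k≤M∸k (≤-reflexive (sym (+-identityʳ D)))) ⟩
      D + (D + 0)  ∎
      where open ≤-Reasoning

    m^s*n^u*[dv*u]^k*n*2^s≤C₀*s!*u!*[M∸k]^k : ∀ m t u → t ≤ s → s ≤ q * t + q → m ≤ M → u + (s + suc t) ≡ k →
      m ^ s * n ^ u * (dv * u) ^ k * n * 2 ^ s ≤ C₀ * (s ! * u ! * D ^ k)
    m^s*n^u*[dv*u]^k*n*2^s≤C₀*s!*u!*[M∸k]^k m t u t≤s s≤qt+q m≤M u+r≡k = *-cancelʳ-≤ _ _ W {{W≢0}} (begin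
      m ^ s * n ^ u * (dv * u) ^ k * n * 2 ^ s * W
        ≡⟨ regroup₁ (m ^ s) (n ^ u) ((dv * u) ^ k) n (2 ^ s) (4 ^ s) (4 ^ u) (2 ^ k) ⟩
      m ^ s * n ^ u * (dv * u) ^ k * n * (2 ^ s * 4 ^ s) * 4 ^ u * 2 ^ k
        ≡⟨ cong (λ z → m ^ s * n ^ u * (dv * u) ^ k * n * z * 4 ^ u * 2 ^ k) ([m*n]^k≡m^k*n^k 2 4 s) ⟨
      m ^ s * n ^ u * (dv * u) ^ k * n * 8 ^ s * 4 ^ u * 2 ^ k
        ≤⟨ m^s*n^u*[dv*u]^k*n*8^s*4^u*2^k≤C₀*s^s*u^u*M^k n m s t u t≤s s≤qt+q sH≤n m≤M u+r≡k ⟩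
      C₀ * s ^ s * u ^ u * M ^ k
        ≤⟨ *-mono-≤ (*-mono-≤ (*-monoʳ-≤ C₀ (n^n≤4^n*n! s)) (n^n≤4^n*n! u))
                    (≤-trans (^-monoˡ-≤ k M≤2*[M∸k]) (≤-reflexive ([m*n]^k≡m^k*n^k 2 D k))) ⟩
      C₀ * (4 ^ s * s !) * (4 ^ u * u !) * (2 ^ k * D ^ k)
        ≡⟨ regroup₂ C₀ (4 ^ s) (s !) (4 ^ u) (u !) (2 ^ k) (D ^ k) ⟩
      C₀ * (s ! * u ! * D ^ k) * W ∎)
      where
      open ≤-Reasoning
      W = 4 ^ s * 4 ^ u * 2 ^ k
      W≢0 : NonZero W
      W≢0 = m*n≢0 (4 ^ s * 4 ^ u) (2 ^ k) {{m*n≢0 (4 ^ s) (4 ^ u) {{m^n≢0 4 s}} {{m^n≢0 4 u}}}} {{m^n≢0 2 k}}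
      regroup₁ : ∀ a b c n e f g h → a * b * c * n * e * (f * g * h) ≡ a * b * c * n * (e * f) * g * h
      regroup₁ = solve-∀
      regroup₂ : ∀ c a b d e f g → c * (a * b) * (d * e) * (f * g) ≡ c * (b * e * g) * (a * d * f)
      regroup₂ = solve-∀

    confinedCount-estimate : ∀ m t u #T #W → t ≤ s → s ≤ q * t + q → m ≤ M → u + (s + suc t) ≡ k →
      #T * s ! ≤ m ^ s → #W * u ! ≤ n ^ u →
      #T * (#W * (fall (dv * u) k * D !)) * (n * 2 ^ s) ≤ C₀ * M !
    confinedCount-estimate m t u #T #W t≤s s≤qt+q m≤M u+r≡k #T-bound #W-bound = *-cancelʳ-≤ _ _ P {{P≢0}} (begin
      #T * (#W * (fall (dv * u) k * D !)) * (n * 2 ^ s) * P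
        ≡⟨ regroup₁ #T #W (fall (dv * u) k) (D !) n (2 ^ s) (s !) (u !) (D ^ k) ⟩
      (#T * s !) * (#W * u !) * fall (dv * u) k * (D ! * D ^ k) * (n * 2 ^ s)
        ≤⟨ *-monoˡ-≤ (n * 2 ^ s) (*-mono-≤ (*-mono-≤ (*-mono-≤ #T-bound #W-bound) (fall≤^ (dv * u) k)) ([m∸k]!*[m∸k]^k≤m! M k)) ⟩
      m ^ s * n ^ u * (dv * u) ^ k * M ! * (n * 2 ^ s)
        ≡⟨ regroup₂ (m ^ s) (n ^ u) ((dv * u) ^ k) (M !) n (2 ^ s) ⟩
      m ^ s * n ^ u * (dv * u) ^ k * n * 2 ^ s * M !
        ≤⟨ *-monoˡ-≤ (M !) (m^s*n^u*[dv*u]^k*n*2^s≤C₀*s!*u!*[M∸k]^k m t u t≤s s≤qt+q m≤M u+r≡k) ⟩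
      C₀ * P * M !
        ≡⟨ regroup₃ C₀ P (M !) ⟩
      C₀ * M ! * P ∎)
      where
      open ≤-Reasoning
      P = s ! * u ! * D ^ k
      P≢0 : NonZero P
      P≢0 = m*n≢0 (s ! * u !) (D ^ k) {{m*n≢0 (s !) (u !) {{s !≢0}} {{u !≢0}}}} {{m^n≢0 D k}}
      regroup₁ : ∀ a b c d n e f g h → a * (b * (c * d)) * (n * e) * (f * g * h) ≡ (a * f) * (b * g) * c * (d * h) * (n * e)
      regroup₁ = solve-∀
      regroup₂ : ∀ a b c d n e → a * b * c * d * (n * e) ≡ a * b * c * n * e * d
      regroup₂ = solve-∀
      regroup₃ : ∀ a b c → a * b * c ≡ a * c * b
      regroup₃ = solve-∀

  -- As δ ≥ 1/q, a set of s checks violating (1 + δ)-expansion touches at most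
  -- allowed s variables (see q[U+s]+s<qA⇒t+slack≤W).
  slack : ℕ → ℕ
  slack s = s + suc (s / q)

  allowed : ℕ → ℕ
  allowed s = s * dc ∸ slack s

  q[U+s]+s<qA⇒t+slack≤W : ∀ A U s t W → q * (U + s) + s < q * A → A + t ≤ U + W → t + slack s ≤ W
  q[U+s]+s<qA⇒t+slack≤W A U s t W q[U+s]+s<qA A+t≤U+W = begin
    t + (s + suc (s / q))   ≡⟨ regroup t s (s / q) ⟩
    (s + t) + suc (s / q)   ≤⟨ +-monoʳ-≤ (s + t) s/q<W∸[s+t] ⟩
    (s + t) + (W ∸ (s + t)) ≡⟨ m+[n∸m]≡n s+t≤W ⟩
    W                       ∎
    where
    open ≤-Reasoning
    regroup : ∀ t s d → t + (s + suc d) ≡ s + t + suc d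
    regroup = solve-∀
    q[s+t]+1+s≤qW : q * (s + t) + suc s ≤ q * W
    q[s+t]+1+s≤qW = +-cancelˡ-≤ (q * U) _ _ (begin
      q * U + (q * (s + t) + suc s)          ≡⟨ expand q U s t ⟩
      suc (q * (U + s) + s) + q * t          ≤⟨ +-monoˡ-≤ (q * t) q[U+s]+s<qA ⟩
      q * A + q * t                          ≡⟨ *-distribˡ-+ q A t ⟨
      q * (A + t)                            ≤⟨ *-monoʳ-≤ q A+t≤U+W ⟩
      q * (U + W)                            ≡⟨ *-distribˡ-+ q U W ⟩
      q * U + q * W                          ∎)
      where
      expand : ∀ q U s t → q * U + (q * (s + t) + suc s) ≡ suc (q * (U + s) + s) + q * t
      expand = solve-∀
    s+t≤W : s + t ≤ W
    s+t≤W = <⇒≤ (*-cancelˡ-< q (s + t) W (≤-trans (s≤s (m≤m+n (q * (s + t)) s)) (≤-trans (≤-reflexive (sym (+-suc _ s))) q[s+t]+1+s≤qW)))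
    s/q<W∸[s+t] : s / q < W ∸ (s + t)
    s/q<W∸[s+t] = *-cancelʳ-< q (s / q) (W ∸ (s + t)) (≤-trans (s≤s (m/n*n≤m s q)) (begin
      suc s                             ≤⟨ +-cancelˡ-≤ (q * (s + t)) _ _ (≤-trans q[s+t]+1+s≤qW
                                             (≤-reflexive (trans (cong (q *_) (sym (m+[n∸m]≡n s+t≤W))) (*-distribˡ-+ q (s + t) _)))) ⟩
      q * (W ∸ (s + t))                 ≡⟨ *-comm q _ ⟩
      (W ∸ (s + t)) * q                 ∎))

  t+slack≤s*dc⇒1≤s : ∀ {s t} → t + slack s ≤ s * dc → 1 ≤ s
  t+slack≤s*dc⇒1≤s {zero}  {t} t+slack≤0 = contradiction (≤-trans (m≤n+m (slack 0) t) t+slack≤0) λ ()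
  t+slack≤s*dc⇒1≤s {suc s} _          = s≤s z≤n

  s≤q*[s/q]+q : ∀ s → s ≤ q * (s / q) + q
  s≤q*[s/q]+q s = begin
    s                         ≡⟨ m≡m%n+[m/n]*n s q ⟩
    s % q + s / q * q         ≤⟨ +-monoˡ-≤ (s / q * q) (<⇒≤ (m%n<n s q)) ⟩
    q + s / q * q             ≡⟨ trans (+-comm q _) (cong (_+ q) (*-comm (s / q) q)) ⟩
    q * (s / q) + q           ∎
    where open ≤-Reasoning

  module _ (n m : ℕ) (balanced : n * dv ≡ m * dc) where
    open ConfigurationModel dv dc n m balanced
    open Cover allowed

    confinedBound*n*2^s≤C₀*M! : ∀ s → 1 ≤ s → s * H ≤ n → confinedBound s * (n * 2 ^ s) ≤ C₀ * (n * dv) !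
    confinedBound*n*2^s≤C₀*M! s 1≤s sH≤n with slack s ≤? s * dc
    ... | yes slack≤ = confinedCount-estimate n s {{>-nonZero 1≤s}} sH≤n m (s / q) (allowed s) (length (subsetsOfSize m s)) (length (subsetsOfSize n (allowed s)))
                         (m/n≤m s q) (s≤q*[s/q]+q s) m≤M (trans (m∸n+n≡m slack≤) (*-comm s dc))
                         (length-subsetsOfSize m s) (length-subsetsOfSize n (allowed s))
      where
      m≤M : m ≤ n * dv
      m≤M = ≤-trans (m≤m*n m dc) (≤-reflexive (sym balanced))
    ... | no  slack≰ rewrite m≤n⇒m∸n≡0 (<⇒≤ (≰⇒> slack≰))
                          | fall-zero (dv * 0) (dc * s) (subst (_< dc * s) (sym (*-zeroʳ dv)) (*-mono-≤ (>-nonZero⁻¹ dc) 1≤s))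
                          | *-zeroʳ (length (subsetsOfSize n 0)) | *-zeroʳ (length (subsetsOfSize m s)) = z≤n

    sumTo-confinedBound : ∀ S → S * H ≤ n → sumTo confinedBound S * n ≤ C₀ * (n * dv) !
    sumTo-confinedBound S SH≤n = subst (_≤ C₀ * (n * dv) !) (sumTo-*ʳ confinedBound n S)
      (sumTo≤ (λ s → confinedBound s * n) (C₀ * (n * dv) !) S λ s 1≤s s≤S →
        ≤-trans (≤-reflexive (*-assoc (confinedBound s) n (2 ^ s)))
                (confinedBound*n*2^s≤C₀*M! s 1≤s (≤-trans (*-monoˡ-≤ H s≤S) SH≤n)))

-- x equals c / (1 + d); the denominator is stored minus one, as in mkℚᵘ.
IsFraction : ℚ → ℕ → ℕ → Set
IsFraction x c d = toℚᵘ x ℚᵘ.≃ mkℚᵘ (ℤ.+ c) d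

isFraction-mkℚ : ∀ p q′ .(c : Coprime p (suc q′)) → IsFraction (mkℚ (ℤ.+ p) q′ c) p q′
isFraction-mkℚ p q′ c = ℚᵘ.≃-refl

isFraction-ℕ→ℚ : ∀ k → IsFraction (ℕ→ℚ k) k 0
isFraction-ℕ→ℚ k = toℚᵘ-cong (normalize-coprime (Coprimality.sym (Coprimality.1-coprimeTo k)))

positive⇒isFraction : ∀ {x} → 0ℚ ℚ.< x → ∃₂ λ p′ q′ → IsFraction x (suc p′) q′
positive⇒isFraction {mkℚ (ℤ.+ suc p′) q′ c} _ = p′ , q′ , ℚᵘ.≃-refl
positive⇒isFraction {mkℚ (ℤ.+ zero)   _  _} 0<x with ℚ.positive 0<x
... | ()
positive⇒isFraction {mkℚ -[1+ _ ]     _  _} 0<x with ℚ.positive 0<x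
... | ()

mkℚᵘ-*-mkℚᵘ : ∀ a b c d → mkℚᵘ (ℤ.+ a) b ℚᵘ.* mkℚᵘ (ℤ.+ c) d ℚᵘ.≃ mkℚᵘ (ℤ.+ (a * c)) (d + b * suc d)
mkℚᵘ-*-mkℚᵘ a b c d = *≡* (cong (ℤ._* (ℤ.+ suc (d + b * suc d))) (sym (ℤ.pos-* a c)))

mkℚᵘ-+-mkℚᵘ : ∀ a b c d → mkℚᵘ (ℤ.+ a) b ℚᵘ.+ mkℚᵘ (ℤ.+ c) d ℚᵘ.≃ mkℚᵘ (ℤ.+ (a * suc d + c * suc b)) (d + b * suc d)
mkℚᵘ-+-mkℚᵘ a b c d = *≡* (cong (ℤ._* (ℤ.+ suc (d + b * suc d)))
  (sym (trans (ℤ.pos-+ (a * suc d) (c * suc b)) (cong₂ ℤ._+_ (ℤ.pos-* a (suc d)) (ℤ.pos-* c (suc b))))))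

isFraction-+ : ∀ {x y k a b} → IsFraction x k 0 → IsFraction y a b → IsFraction (x ℚ.+ y) (k * suc b + a) b
isFraction-+ {x} {y} {k} {a} {b} x≐ y≐ = ℚᵘ.≃-trans (toℚᵘ-homo-+ x y) (ℚᵘ.≃-trans (ℚᵘ.+-cong x≐ y≐)
  (ℚᵘ.≃-trans (mkℚᵘ-+-mkℚᵘ k 0 a b)
  (ℚᵘ.≃-reflexive (cong₂ (λ u v → mkℚᵘ (ℤ.+ u) v) (cong (k * suc b +_) (*-identityʳ a)) (+-identityʳ b)))))

isFraction-*ℕ→ℚ : ∀ {x a b} k → IsFraction x a b → IsFraction (x ℚ.* ℕ→ℚ k) (a * k) b
isFraction-*ℕ→ℚ {x} {a} {b} k x≐ = ℚᵘ.≃-trans (toℚᵘ-homo-* x (ℕ→ℚ k)) (ℚᵘ.≃-trans (ℚᵘ.*-cong x≐ (isFraction-ℕ→ℚ k))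
  (ℚᵘ.≃-trans (mkℚᵘ-*-mkℚᵘ a b k 0) (ℚᵘ.≃-reflexive (cong (mkℚᵘ (ℤ.+ (a * k))) (*-identityʳ b)))))

ℕ→ℚ≤⇒ : ∀ {x c d} a → IsFraction x c d → ℕ→ℚ a ℚ.≤ x → a * suc d ≤ c
ℕ→ℚ≤⇒ {x} {c} {d} a x≐ a≤x with ℚᵘ.≤-respʳ-≃ x≐ (ℚᵘ.≤-respˡ-≃ (isFraction-ℕ→ℚ a) (toℚᵘ-mono-≤ a≤x))
... | *≤* le = subst (a * suc d ≤_) (*-identityʳ c)
                 (ℤ.drop‿+≤+ (subst₂ ℤ._≤_ (sym (ℤ.pos-* a (suc d))) (sym (ℤ.pos-* c 1)) le))

⇒ℕ→ℚ≤ : ∀ {x c d} a → IsFraction x c d → a * suc d ≤ c → ℕ→ℚ a ℚ.≤ x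
⇒ℕ→ℚ≤ {x} {c} {d} a x≐ a*[1+d]≤c = toℚᵘ-cancel-≤ (ℚᵘ.≤-respˡ-≃ (ℚᵘ.≃-sym (isFraction-ℕ→ℚ a)) (ℚᵘ.≤-respʳ-≃ (ℚᵘ.≃-sym x≐)
  (*≤* (subst₂ ℤ._≤_ (ℤ.pos-* a (suc d)) (ℤ.pos-* c 1) (ℤ.+≤+ (subst (a * suc d ≤_) (sym (*-identityʳ c)) a*[1+d]≤c))))))


module Expansion (dv dc : ℕ) .{{_ : NonZero dv}} .{{_ : NonZero dc}} (δ : ℚ) (p′ q′ : ℕ) (δ≐ : IsFraction δ (suc p′) q′) where

  open TailBound dv dc (suc q′)

  η : ℚ
  η = mkℚ (ℤ.+ 1) H (Coprimality.1-coprimeTo (suc H))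

  0<η : 0ℚ ℚ.< η
  0<η = positive⁻¹ η

  q*A≤q*[U+s]+s⇒A≤U+[1+δ]*s : ∀ A U s → suc q′ * A ≤ suc q′ * (U + s) + s →
    ℕ→ℚ A ℚ.≤ ℕ→ℚ U ℚ.+ (1ℚ ℚ.+ δ) ℚ.* ℕ→ℚ s
  q*A≤q*[U+s]+s⇒A≤U+[1+δ]*s A U s qA≤ = ⇒ℕ→ℚ≤ A
    (isFraction-+ (isFraction-ℕ→ℚ U) (isFraction-*ℕ→ℚ s (isFraction-+ {1ℚ} {δ} {1} ℚᵘ.≃-refl δ≐))) (begin
      A * suc q′                                    ≡⟨ *-comm A (suc q′) ⟩
      suc q′ * A                                    ≤⟨ qA≤ ⟩
      suc q′ * (U + s) + s                          ≤⟨ +-monoʳ-≤ (suc q′ * (U + s)) (m≤n*m s (suc p′)) ⟩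
      suc q′ * (U + s) + suc p′ * s                 ≡⟨ regroup U q′ p′ s ⟩
      U * suc q′ + (1 * suc q′ + suc p′) * s        ∎)
    where
    open ≤-Reasoning
    regroup : ∀ U q p s → (1 + q) * (U + s) + (1 + p) * s ≡ U * (1 + q) + (1 * (1 + q) + (1 + p)) * s
    regroup = solve-∀

  module _ (n m : ℕ) (balanced : n * dv ≡ m * dc) where
    open ConfigurationModel dv dc n m balanced
    open Cover allowed

    bad : List Sockets′
    bad = confinedUpTo (n / suc H)

    length-bad : ∀ e′ → C₀ * suc e′ ≤ n → length bad * suc e′ ≤ (n * dv) !
    length-bad e′ C₀[1+e′]≤n = *-cancelʳ-≤ _ _ C₀ {{C₀≢0}} (begin
      length bad * suc e′ * C₀                      ≡⟨ trans (*-assoc (length bad) (suc e′) C₀) (cong (length bad *_) (*-comm (suc e′) C₀)) ⟩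
      length bad * (C₀ * suc e′)                    ≤⟨ *-mono-≤ (length-confinedUpTo (n / suc H)) C₀[1+e′]≤n ⟩
      sumTo confinedBound (n / suc H) * n           ≤⟨ sumTo-confinedBound n m balanced (n / suc H) [n/[1+H]]*H≤n ⟩
      C₀ * (n * dv) !                               ≡⟨ *-comm C₀ _ ⟩
      (n * dv) ! * C₀                               ∎)
      where
      open ≤-Reasoning
      C₀≢0 : NonZero C₀
      C₀≢0 = m*n≢0 (dc * suc q′) (K ^ suc q′) {{m*n≢0 dc (suc q′)}} {{m^n≢0 K (suc q′)}}
      [n/[1+H]]*H≤n : n / suc H * H ≤ n
      [n/[1+H]]*H≤n = ≤-trans (*-monoʳ-≤ (n / suc H) (n≤1+n H)) (m/n*n≤m n (suc H))

    small⇒s*[1+H]≤n : ∀ s → ℕ→ℚ s ℚ.≤ η ℚ.* ℕ→ℚ n → s * suc H ≤ n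
    small⇒s*[1+H]≤n s small = subst (s * suc H ≤_) (+-identityʳ n)
      (ℕ→ℚ≤⇒ s (isFraction-*ℕ→ℚ n (isFraction-mkℚ 1 H (Coprimality.1-coprimeTo (suc H)))) small)

    nonexpanding⇒t+slack≤s*dc : ∀ π S →
      ¬ (ℕ→ℚ (sum (map (degree dv dc n m π) S)) ℚ.≤ ℕ→ℚ (unionSize dv dc n m π S) ℚ.+ (1ℚ ℚ.+ δ) ℚ.* ℕ→ℚ (length S)) →
      count (touched π S) + slack (length S) ≤ length S * dc
    nonexpanding⇒t+slack≤s*dc π S nonexpanding =
      q[U+s]+s<qA⇒t+slack≤W A U (length S) (count (touched π S)) (length S * dc)
        (≰⇒> (λ le → nonexpanding (q*A≤q*[U+s]+s⇒A≤U+[1+δ]*s A U (length S) le)))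
        (∑degree+touched≤union+dc*|S| π S)
      where
      A = sum (map (degree dv dc n m π) S)
      U = unionSize dv dc n m π S

    enlarge-touched : ∀ π S {s} → s * suc H ≤ n → count (touched π S) + slack s ≤ s * dc →
      Σ[ W ∈ Vec Bool n ] (size W ≡ allowed s × touchedVector π S ⊆ᵇ W)
    enlarge-touched π S {s} s*[1+H]≤n t+slack≤s*dc = enlarge (touchedVector π S) (allowed s) t≤allowed allowed≤n
      where
      allowed≤n : allowed s ≤ n
      allowed≤n = ≤-trans (m∸n≤m (s * dc) (slack s))
                    (≤-trans (*-monoʳ-≤ s (≤-trans (m≤n*m dc 2) (≤-trans 2*dc≤H (n≤1+n H)))) s*[1+H]≤n)
      t≤allowed : size (touchedVector π S) ≤ allowed s
      t≤allowed = ≤-trans (≤-reflexive (size-tabulate (touched π S)))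
                    (≤-trans (≤-reflexive (sym (m+n∸n≡m (count (touched π S)) (slack s)))) (∸-monoˡ-≤ (slack s) t+slack≤s*dc))

    nonexpanding-set⇒∈bad : ∀ π S → Unique S → ℕ→ℚ (length S) ℚ.≤ η ℚ.* ℕ→ℚ n →
      ¬ (ℕ→ℚ (sum (map (degree dv dc n m π) S)) ℚ.≤ ℕ→ℚ (unionSize dv dc n m π S) ℚ.+ (1ℚ ℚ.+ δ) ℚ.* ℕ→ℚ (length S)) →
      Any (SamePerm dv dc n m π) bad
    nonexpanding-set⇒∈bad π S unique small nonexpanding = confined (enlarge-touched π S s*[1+H]≤n t+slack≤s*dc)
      where
      s*[1+H]≤n : length S * suc H ≤ n
      s*[1+H]≤n = small⇒s*[1+H]≤n (length S) small
      t+slack≤s*dc : count (touched π S) + slack (length S) ≤ length S * dc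
      t+slack≤s*dc = nonexpanding⇒t+slack≤s*dc π S nonexpanding
      confined : Σ[ W ∈ Vec Bool n ] (size W ≡ allowed (length S) × touchedVector π S ⊆ᵇ W) → Any (SamePerm dv dc n m π) bad
      confined (W , ∣W∣≡u , touched⊆W) =
        ∈-confinedUpTo π (length S) (memberVector S) W (n / suc H) (t+slack≤s*dc⇒1≤s {length S} {count (touched π S)} t+slack≤s*dc)
          (≤-trans (≤-reflexive (sym (m*n/n≡m (length S) (suc H)))) (/-monoˡ-≤ (suc H) s*[1+H]≤n))
          (trans (size-tabulate (isMember S)) (count-isMember S unique)) ∣W∣≡u
          (Confines-⊆ {π} {memberVector S} {touchedVector π S} {W} touched⊆W (touched-confines π S))

    nonexpanding⇒∈bad : ∀ π → ¬ Expanding dv dc n m π (η ℚ.* ℕ→ℚ n) (1ℚ ℚ.+ δ) → Any (SamePerm dv dc n m π) bad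
    -- Membership in bad and the expansion inequality are decidable, which removes the double negation.
    nonexpanding⇒∈bad π nonexpanding =
      decidable-stable (any? (λ σ → all? (λ i → π ⟨$⟩ʳ i Fin.≟ σ ⟨$⟩ʳ i)) bad) λ ∉bad →
        nonexpanding λ S unique small →
          decidable-stable (ℕ→ℚ (sum (map (degree dv dc n m π) S))
                              ℚ.≤? ℕ→ℚ (unionSize dv dc n m π S) ℚ.+ (1ℚ ℚ.+ δ) ℚ.* ℕ→ℚ (length S))
            λ nonexpanding-S → ∉bad (nonexpanding-set⇒∈bad π S unique small nonexpanding-S)

  theorem : ∃[ η ] (0ℚ ℚ.< η ×
      ((ε : ℚ) → 0ℚ ℚ.< ε → ∃[ N ] ((n m : ℕ) → N ≤ n → n * dv ≡ m * dc →
        FailureProbAtMost dv dc n m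
          (λ π → Expanding dv dc n m π (η ℚ.* ℕ→ℚ n) (1ℚ ℚ.+ δ)) ε)))
  theorem = η , 0<η , λ ε 0<ε → failure≤ ε (positive⇒isFraction 0<ε)
    where
    failure≤ : ∀ ε → (∃₂ λ e e′ → IsFraction ε (suc e) e′) → ∃[ N ] ((n m : ℕ) → N ≤ n → n * dv ≡ m * dc →
      FailureProbAtMost dv dc n m (λ π → Expanding dv dc n m π (η ℚ.* ℕ→ℚ n) (1ℚ ℚ.+ δ)) ε)
    failure≤ ε (e , e′ , ε≐) = C₀ * suc e′ , λ n m N≤n balanced →
      bad n m balanced ,
      ⇒ℕ→ℚ≤ (length (bad n m balanced)) (isFraction-*ℕ→ℚ ((n * dv) !) ε≐)
        (≤-trans (length-bad n m balanced e′ N≤n) (m≤n*m ((n * dv) !) (suc e))) ,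
      nonexpanding⇒∈bad n m balanced

lemma3 : (dv dc : ℕ) .{{_ : NonZero dv}} .{{_ : NonZero dc}} →
    (δ : ℚ) → 0ℚ ℚ.< δ → δ ℚ.< ℚ.½ →
    ∃[ η ] (0ℚ ℚ.< η ×
      ((ε : ℚ) → 0ℚ ℚ.< ε → ∃[ N ] ((n m : ℕ) → N ≤ n → n * dv ≡ m * dc →
        FailureProbAtMost dv dc n m
          (λ π → Expanding dv dc n m π (η ℚ.* ℕ→ℚ n) (1ℚ ℚ.+ δ)) ε)))
lemma3 dv dc δ 0<δ _ = Expansion.theorem dv dc δ p′ q′ δ≐
  where
  p′ = proj₁ (positive⇒isFraction 0<δ)
  q′ = proj₁ (proj₂ (positive⇒isFraction 0<δ))
  δ≐ = proj₂ (proj₂ (positive⇒isFraction 0<δ))
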